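{- Let $M$ be a connected matroid of rank $r$ on $[n]$ and let $X\subseteq\operatorname{Inc}(\mathcal{B}_M)$ be a set of $n$ incidence vectors of bases of $M$. If $g(X)$ is connected, then $\operatorname{rank}(X)=n$. Moreover, $G(X)$ is connected and thus $|\det(X)|=r$.
   Context: A matroid is connected if every two ground set elements lie in a common circuit. $\operatorname{Inc}(\mathcal{B}_M)=\{\mathbf{e}_B:B\text{ a basis of }M\}$ with $\mathbf{e}_B=\sum_{i\in B}\mathbf{e}_i\in\mathbb{R}^n$. $X$ is regarded as the $n\times n$ matrix whose rows are its elements. $G(X)$ is the graph whose vertices are the vectors of $X$, with an edge between $\mathbf{X}_i,\mathbf{X}_j\in X$ whenever $\mathbf{X}_i-\mathbf{X}_j=\mathbf{e}_s-\mathbf{e}_t$ for some $s,t$. $g(X)$ is the graph on vertex set $[n]$ with an edge $\{i,j\}$ whenever there exist $\mathbf{X}_s,\mathbf{X}_t\in X$ with $\mathbf{X}_s-\mathbf{X}_t=\mathbf{e}_i-\mathbf{e}_j$. -}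

module Defs where

open import Data.Nat as ℕ using (ℕ; zero; suc)
open import Data.Integer as ℤ using (ℤ; +_)
open import Data.Rational as ℚ using (ℚ; 0ℚ; 1ℚ)
open import Data.Fin using (Fin; zero; suc; punchIn)
open import Data.Fin.Subset using (Subset; _∈_; _∉_; _⊆_; _-_; _∪_; ⁅_⁆; ∣_∣)
open import Data.Fin.Subset.Properties using (_∈?_)
open import Data.Product using (Σ; ∃; ∃-syntax; _×_; _,_)
open import Data.Empty using (⊥)
open import Relation.Nullary using (¬_; yes; no)
open import Relation.Binary.PropositionalEquality using (_≡_; _≢_)
open import Relation.Binary.Construct.Closure.ReflexiveTransitive using (Star)

record Matroid (n : ℕ) : Set₁ where
  field
    IsBasis  : Subset n → Set
    nonempty : ∃[ B ] IsBasis B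
    exchange : ∀ {B₁ B₂} → IsBasis B₁ → IsBasis B₂ →
               ∀ {x} → x ∈ B₁ → x ∉ B₂ →
               ∃[ y ] (y ∈ B₂ × y ∉ B₁ × IsBasis ((B₁ - x) ∪ ⁅ y ⁆))

module _ {n : ℕ} (M : Matroid n) where
  open Matroid M

  Independent : Subset n → Set
  Independent I = ∃[ B ] (IsBasis B × I ⊆ B)

  Dependent : Subset n → Set
  Dependent I = ¬ Independent I

  IsCircuit : Subset n → Set
  IsCircuit C = Dependent C × (∀ {e} → e ∈ C → Independent (C - e))

  HasRank : ℕ → Set
  HasRank r = ∀ B → IsBasis B → ∣ B ∣ ≡ r

  Connected : Set
  Connected = ∀ (i j : Fin n) → i ≢ j → ∃[ C ] (IsCircuit C × i ∈ C × j ∈ C)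

incℤ : {n : ℕ} → Subset n → Fin n → ℤ
incℤ B k with k ∈? B
... | yes _ = + 1
... | no  _ = + 0

incℚ : {n : ℕ} → Subset n → Fin n → ℚ
incℚ B k with k ∈? B
... | yes _ = 1ℚ
... | no  _ = 0ℚ

eℤ : {n : ℕ} → Fin n → Fin n → ℤ
eℤ s k with s Data.Fin.≟ k
... | yes _ = + 1
... | no  _ = + 0
  where import Data.Fin

matℤ : {n : ℕ} → (Fin n → Subset n) → Fin n → Fin n → ℤ
matℤ X i = incℤ (X i)

matℚ : {n : ℕ} → (Fin n → Subset n) → Fin n → Fin n → ℚ
matℚ X i = incℚ (X i)

sumℚ : (n : ℕ) → (Fin n → ℚ) → ℚ
sumℚ zero    f = 0ℚ
sumℚ (suc n) f = f zero ℚ.+ sumℚ n (λ i → f (suc i))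

sumℤ : (n : ℕ) → (Fin n → ℤ) → ℤ
sumℤ zero    f = + 0
sumℤ (suc n) f = f zero ℤ.+ sumℤ n (λ i → f (suc i))

sgn : ℕ → ℤ
sgn zero    = + 1
sgn (suc k) = ℤ.- sgn k

det : (n : ℕ) → (Fin n → Fin n → ℤ) → ℤ
det zero    A = + 1
det (suc n) A =
  sumℤ (suc n) (λ j → sgn (Data.Fin.toℕ j) ℤ.* (A zero j ℤ.* det n (λ i k → A (suc i) (punchIn j k))))
  where import Data.Fin

-- rows of an n×n rational matrix are linearly independent, i.e. rank(A) = n
RankFull : (n : ℕ) → (Fin n → Fin n → ℚ) → Set
RankFull n A = ∀ (c : Fin n → ℚ) →
  (∀ k → sumℚ n (λ i → c i ℚ.* A i k) ≡ 0ℚ) → ∀ i → c i ≡ 0ℚ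

DiffIsEdge : {n : ℕ} → (Fin n → ℤ) → (Fin n → ℤ) → Fin n → Fin n → Set
DiffIsEdge u v s t = ∀ k → u k ℤ.- v k ≡ eℤ s k ℤ.- eℤ t k

-- G(X): vertices are the rows of X (indexed by Fin n)
GEdge : {n : ℕ} → (Fin n → Subset n) → Fin n → Fin n → Set
GEdge X a b = ∃[ s ] ∃[ t ] DiffIsEdge (matℤ X a) (matℤ X b) s t

-- g(X): vertex set [n]
gEdge : {n : ℕ} → (Fin n → Subset n) → Fin n → Fin n → Set
gEdge X i j = ∃[ s ] ∃[ t ] DiffIsEdge (matℤ X s) (matℤ X t) i j

GraphConnected : {n : ℕ} → (Fin n → Fin n → Set) → Set
GraphConnected {n} E = ∀ (u v : Fin n) → Star (λ a b → E a b Data.Sum.⊎ E b a) u v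
  where import Data.Sum

module Submission where

open import Defs
open import Data.Nat using (ℕ; _≤_)
open import Data.Integer using (∣_∣)
open import Data.Fin using (Fin)
open import Data.Fin.Subset using (Subset)
open import Data.Product using (_×_)
open import Function.Definitions using (Injective)
open import Relation.Binary.PropositionalEquality using (_≡_)

-- Let x = e_{X_0} and let B be the matrix with rows x, e_1 - e_0, …, e_{n-1} - e_0;
-- expanding along the first row, det B = Σ x = r. Every edge {i, j} of g(X) is a difference
-- e_{X_s} - e_{X_t} = e_i - e_j along an edge {s, t} of G(X), so a walk from k to 0 in g(X)
-- writes e_k - e_0 as an integral combination of the rows of X whose coefficient vector is a
-- sum of vectors e_s - e_t over edges of G(X). This gives an integral P with P·X = B; and
-- since all rows have coordinate sum r, X = Q·B for an integral Q. Hence det P · det X = r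
-- and det X = det Q · r, so det P · det Q = 1 and |det X| = r; over ℚ, det X ≠ 0 gives rank n.
-- If G(X) were disconnected, the indicator ψ of the rows not reachable from row 0 would be
-- constant along the edges of G(X), so P ψ = 0 with ψ ≠ 0 and det P = 0, which is impossible.

open import Level using (0ℓ)
open import Data.Nat as ℕ using (zero; suc)
import Data.Nat.Properties as ℕP
open import Data.Fin using (zero; suc; punchIn; punchOut; toℕ; _≟_)
open import Data.Fin.Properties
  using (punchInᵢ≢i; punchIn-punchOut; punchOut-punchIn; punchOut-cong; punchIn-injective; suc-injective; any?; all?)
open import Data.Fin.Subset using (inside; outside; _∈_; _∉_; _⊃_; _∪_; ⁅_⁆) renaming (∣_∣ to ∣_∣ₛ)
open import Data.Fin.Subset.Properties using (_∈?_; x∈⁅x⁆; x∈⁅y⁆⇒x≡y; p⊆p∪q; x∈p∪q⁺; x∈p∪q⁻)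
open import Data.Fin.Subset.Induction using (⊃-wellFounded)
open import Data.Vec.Functional using (Vector; _∷_; updateAt; insertAt)
open import Data.Vec.Functional.Properties
  using (updateAt-updates; updateAt-minimal; updateAt-id-local; updateAt-commutes; insertAt-lookup; insertAt-punchIn)
import Data.Vec as Vec
open import Data.Integer as ℤ using (ℤ)
import Data.Integer.Properties as ℤP
open import Data.Rational as ℚ using (0ℚ; 1ℚ)
import Data.Rational.Properties as ℚP
open import Data.Product using (_,_)
open import Data.Sum using (_⊎_; inj₁; inj₂)
open import Data.Empty using (⊥-elim)
open import Function using (_∘_; const)
open import Induction.WellFounded using (Acc; acc)
open import Relation.Nullary using (Dec; yes; no)
open import Relation.Nullary.Decidable using (_×-dec_; _⊎-dec_; ¬?)
open import Relation.Binary.PropositionalEquality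
open import Relation.Binary.Construct.Closure.ReflexiveTransitive
  using (Star; ε; _◅_; _◅◅_) renaming (reverse to Star-reverse)
open import Algebra.Structures using (IsCommutativeRing)
open import Algebra.Bundles using (CommutativeRing)

data Bit : ℤ → Set where
  𝟎 : Bit (ℤ.+ 0)
  𝟏 : Bit (ℤ.+ 1)

bit-difference : ∀ {a b c d} → Bit a → Bit b → Bit c → Bit d → a ℤ.- b ≡ c ℤ.- d →
                 (a ≡ c × b ≡ d) ⊎ (a ≡ b × c ≡ d)
bit-difference 𝟎 𝟎 𝟎 𝟎 _  = inj₁ (refl , refl)
bit-difference 𝟎 𝟎 𝟎 𝟏 ()
bit-difference 𝟎 𝟎 𝟏 𝟎 ()
bit-difference 𝟎 𝟎 𝟏 𝟏 _  = inj₂ (refl , refl)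
bit-difference 𝟎 𝟏 𝟎 𝟎 ()
bit-difference 𝟎 𝟏 𝟎 𝟏 _  = inj₁ (refl , refl)
bit-difference 𝟎 𝟏 𝟏 𝟎 ()
bit-difference 𝟎 𝟏 𝟏 𝟏 ()
bit-difference 𝟏 𝟎 𝟎 𝟎 ()
bit-difference 𝟏 𝟎 𝟎 𝟏 ()
bit-difference 𝟏 𝟎 𝟏 𝟎 _  = inj₁ (refl , refl)
bit-difference 𝟏 𝟎 𝟏 𝟏 ()
bit-difference 𝟏 𝟏 𝟎 𝟎 _  = inj₂ (refl , refl)
bit-difference 𝟏 𝟏 𝟎 𝟏 ()
bit-difference 𝟏 𝟏 𝟏 𝟎 ()
bit-difference 𝟏 𝟏 𝟏 𝟏 _  = inj₁ (refl , refl)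

incℤ-bit : ∀ {n} (B : Subset n) k → Bit (incℤ B k)
incℤ-bit B k with k ∈? B
... | yes _ = 𝟏
... | no  _ = 𝟎

eℤ-bit : ∀ {n} (a k : Fin n) → Bit (eℤ a k)
eℤ-bit a k with a ≟ k
... | yes _ = 𝟏
... | no  _ = 𝟎

module LinearAlgebra {R : Set} {plus times : R → R → R} {neg : R → R} {zeroR oneR : R}
  (isCommutativeRing : IsCommutativeRing _≡_ plus times neg zeroR oneR) where

  commutativeRing : CommutativeRing 0ℓ 0ℓ
  commutativeRing = record { isCommutativeRing = isCommutativeRing }

  open CommutativeRing commutativeRing public
    using (_+_; _*_; -_; _-_; 0#; 1#; +-assoc; +-comm; +-identityˡ; +-identityʳ; -‿inverseˡ; -‿inverseʳ;
           *-assoc; *-comm; *-identityˡ; *-identityʳ; distribˡ; distribʳ; zeroˡ; zeroʳ)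
  open import Algebra.Properties.Ring (CommutativeRing.ring commutativeRing) public
    using (-‿distribˡ-*; -‿distribʳ-*; -‿involutive; -0#≈0#; +-inverseʳ-unique; x+x≈x⇒x≈0)
  open import Algebra.Properties.Semiring.Sum (CommutativeRing.semiring commutativeRing) public
    using (sum; sum-cong-≗; sum-replicate-zero; ∑-distrib-+; sum-remove; *-distribˡ-sum; *-distribʳ-sum)
  open import Algebra.Properties.AbelianGroup (CommutativeRing.+-abelianGroup commutativeRing) public
    using (⁻¹-∙-comm) renaming (⁻¹-anti-homo‿- to -‿flip)
  open import Algebra.Properties.CommutativeSemigroup (CommutativeRing.*-commutativeSemigroup commutativeRing) public
    using () renaming (x∙yz≈y∙xz to *-leftComm)
  open ≡-Reasoning

  telescope : ∀ x y z → (x - y) + (y - z) ≡ x - z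
  telescope x y z = begin
    (x - y) + (y - z)   ≡⟨ +-assoc x (- y) (y - z) ⟩
    x + (- y + (y - z)) ≡⟨ cong (x +_) (sym (+-assoc (- y) y (- z))) ⟩
    x + ((- y + y) - z) ≡⟨ cong (λ w → x + (w - z)) (-‿inverseˡ y) ⟩
    x + (0# - z)        ≡⟨ cong (x +_) (+-identityˡ (- z)) ⟩
    x - z               ∎

  x+[y-x]≡y : ∀ x y → x + (y - x) ≡ y
  x+[y-x]≡y x y = begin
    x + (y - x)     ≡⟨ cong (x +_) (+-comm y (- x)) ⟩
    x + (- x + y)   ≡⟨ sym (+-assoc x (- x) y) ⟩
    (x - x) + y     ≡⟨ cong (_+ y) (-‿inverseʳ x) ⟩
    0# + y          ≡⟨ +-identityˡ y ⟩
    y               ∎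

  -x*-y≡x*y : ∀ x y → - x * - y ≡ x * y
  -x*-y≡x*y x y = begin
    - x * - y     ≡⟨ sym (-‿distribˡ-* x (- y)) ⟩
    - (x * - y)   ≡⟨ cong -_ (sym (-‿distribʳ-* x y)) ⟩
    - - (x * y)   ≡⟨ -‿involutive (x * y) ⟩
    x * y         ∎

  sum-zero : ∀ {n} {f : Vector R n} → (∀ i → f i ≡ 0#) → sum f ≡ 0#
  sum-zero {n} f≡0 = trans (sum-cong-≗ f≡0) (sum-replicate-zero n)

  sum-neg : ∀ {n} (f : Vector R n) → sum (λ i → - f i) ≡ - sum f
  sum-neg {zero}  f = sym -0#≈0#
  sum-neg {suc n} f = trans (cong (- f zero +_) (sum-neg (f ∘ suc))) (⁻¹-∙-comm (f zero) (sum (f ∘ suc)))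

  sum-sub : ∀ {n} (a b : Vector R n) → sum (λ k → a k - b k) ≡ sum a - sum b
  sum-sub a b = trans (∑-distrib-+ a (λ k → - b k)) (cong (sum a +_) (sum-neg b))

  sum-neg-coefficients : ∀ {n} (w f : Vector R n) → sum (λ s → - w s * f s) ≡ - sum (λ s → w s * f s)
  sum-neg-coefficients w f = trans (sum-cong-≗ (λ s → sym (-‿distribˡ-* (w s) (f s)))) (sum-neg (λ s → w s * f s))

  sum-+-coefficients : ∀ {n} (w₁ w₂ f : Vector R n) →
                       sum (λ s → (w₁ s + w₂ s) * f s) ≡ sum (λ s → w₁ s * f s) + sum (λ s → w₂ s * f s)
  sum-+-coefficients w₁ w₂ f = trans (sum-cong-≗ (λ s → distribʳ (f s) (w₁ s) (w₂ s)))
                                     (∑-distrib-+ (λ s → w₁ s * f s) (λ s → w₂ s * f s))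

  sum-combination : ∀ {n} c (x y : Vector R n) → sum (λ j → c * x j + y j) ≡ c * sum x + sum y
  sum-combination c x y = trans (∑-distrib-+ (λ j → c * x j) y) (cong (_+ sum y) (sym (*-distribˡ-sum c x)))

  sum-single : ∀ {n} (j : Fin n) {f : Vector R n} → (∀ i → i ≢ j → f i ≡ 0#) → sum f ≡ f j
  sum-single {suc n} j {f} others = begin
    sum f                             ≡⟨ sum-remove {i = j} f ⟩
    f j + sum (f ∘ punchIn j)         ≡⟨ cong (f j +_) (sum-zero (λ l → others _ (punchInᵢ≢i j l))) ⟩
    f j + 0#                          ≡⟨ +-identityʳ (f j) ⟩
    f j                               ∎

  ≗-split : ∀ {n} {A : Set} (j : Fin (suc n)) {f g : Vector A (suc n)} →
            f j ≡ g j → (∀ l → f (punchIn j l) ≡ g (punchIn j l)) → ∀ k → f k ≡ g k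
  ≗-split j {f} {g} at-j off-j k with j ≟ k
  ... | yes refl = at-j
  ... | no j≢k   = subst (λ k′ → f k′ ≡ g k′) (punchIn-punchOut j≢k) (off-j (punchOut j≢k))

  δ : ∀ {n} → Fin n → Vector R n
  δ i k with i ≟ k
  ... | yes _ = 1#
  ... | no  _ = 0#

  δ-diag : ∀ {n} (i : Fin n) → δ i i ≡ 1#
  δ-diag i with i ≟ i
  ... | yes _  = refl
  ... | no i≢i = ⊥-elim (i≢i refl)

  δ-off : ∀ {n} {i k : Fin n} → i ≢ k → δ i k ≡ 0#
  δ-off {i = i} {k} i≢k with i ≟ k
  ... | yes i≡k = ⊥-elim (i≢k i≡k)
  ... | no  _   = refl

  δ-punchIn : ∀ {n} (j : Fin (suc n)) (a b : Fin n) → δ (punchIn j a) (punchIn j b) ≡ δ a b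
  δ-punchIn j a b with a ≟ b
  ... | yes refl = δ-diag (punchIn j a)
  ... | no a≢b   = δ-off (a≢b ∘ punchIn-injective j a b)

  sum-δˡ : ∀ {n} (j : Fin n) (f : Vector R n) → sum (λ i → δ j i * f i) ≡ f j
  sum-δˡ j f = trans (sum-single j (λ i i≢j → trans (cong (_* f i) (δ-off (i≢j ∘ sym))) (zeroˡ (f i))))
                     (trans (cong (_* f j) (δ-diag j)) (*-identityˡ (f j)))

  sum-δʳ : ∀ {n} (j : Fin n) (f : Vector R n) → sum (λ i → f i * δ i j) ≡ f j
  sum-δʳ j f = trans (sum-single j (λ i i≢j → trans (cong (f i *_) (δ-off i≢j)) (zeroʳ (f i))))
                     (trans (cong (f j *_) (δ-diag j)) (*-identityʳ (f j)))

  sum-δ-difference : ∀ {n} (a b : Fin n) (f : Vector R n) → sum (λ σ → (δ a σ - δ b σ) * f σ) ≡ f a - f b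
  sum-δ-difference a b f = begin
    sum (λ σ → (δ a σ - δ b σ) * f σ)
      ≡⟨ sum-cong-≗ (λ σ → trans (distribʳ (f σ) _ _) (cong (δ a σ * f σ +_) (sym (-‿distribˡ-* _ _)))) ⟩
    sum (λ σ → δ a σ * f σ - δ b σ * f σ)             ≡⟨ sum-sub (λ σ → δ a σ * f σ) (λ σ → δ b σ * f σ) ⟩
    sum (λ σ → δ a σ * f σ) - sum (λ σ → δ b σ * f σ) ≡⟨ cong₂ _-_ (sum-δˡ a f) (sum-δˡ b f) ⟩
    f a - f b                                         ∎

  Mat : ℕ → ℕ → Set
  Mat m n = Vector (Vector R n) m

  infix 4 _≋_
  _≋_ : ∀ {m n} → Mat m n → Mat m n → Set
  A ≋ B = ∀ i k → A i k ≡ B i k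

  I : ∀ {n} → Mat n n
  I = δ

  infixl 7 _·_
  _·_ : ∀ {m l n} → Mat m l → Mat l n → Mat m n
  (A · B) i k = sum (λ j → A i j * B j k)

  infixl 6 _[_]≔_
  _[_]≔_ : ∀ {m n} → Mat m n → Fin m → Vector R n → Mat m n
  A [ i ]≔ u = updateAt A i (const u)

  ≔-updates : ∀ {m n} (A : Mat m n) i u → (A [ i ]≔ u) i ≡ u
  ≔-updates A i u = updateAt-updates i A

  ≔-minimal : ∀ {m n} (A : Mat m n) {i j} u → j ≢ i → (A [ i ]≔ u) j ≡ A j
  ≔-minimal A {i} {j} u j≢i = updateAt-minimal j i A j≢i

  ≔-cong : ∀ {m n} {A B : Mat m n} i {u v : Vector R n} → A ≋ B → (∀ k → u k ≡ v k) →
           A [ i ]≔ u ≋ B [ i ]≔ v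
  ≔-cong {A = A} {B} i {u} {v} A≋B u≗v j k with j ≟ i
  ... | yes refl = trans (cong-app (≔-updates A j u) k) (trans (u≗v k) (sym (cong-app (≔-updates B j v) k)))
  ... | no j≢i   = trans (cong-app (≔-minimal A u j≢i) k) (trans (A≋B j k) (sym (cong-app (≔-minimal B v j≢i) k)))

  ≔-self : ∀ {m n} (A : Mat m n) i → A [ i ]≔ A i ≋ A
  ≔-self A i j k = cong-app (updateAt-id-local i A refl j) k

  ≔-comm : ∀ {m n} (A : Mat m n) {i j} u v → i ≢ j → (A [ i ]≔ u) [ j ]≔ v ≋ (A [ j ]≔ v) [ i ]≔ u
  ≔-comm A {i} {j} u v i≢j a k = cong-app (updateAt-commutes j i (i≢j ∘ sym) A a) k

  record IsMultilinear {m n} (D : Mat m n → R) : Set where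
    field
      D-cong : ∀ {A B} → A ≋ B → D A ≡ D B
      linear : ∀ A i c u v → D (A [ i ]≔ (λ k → c * u k + v k)) ≡ c * D (A [ i ]≔ u) + D (A [ i ]≔ v)

    additive : ∀ A i u v → D (A [ i ]≔ (λ k → u k + v k)) ≡ D (A [ i ]≔ u) + D (A [ i ]≔ v)
    additive A i u v = begin
      D (A [ i ]≔ (λ k → u k + v k))
        ≡⟨ D-cong (≔-cong i (λ _ _ → refl) (λ k → cong (_+ v k) (sym (*-identityˡ (u k))))) ⟩
      D (A [ i ]≔ (λ k → 1# * u k + v k)) ≡⟨ linear A i 1# u v ⟩
      1# * D (A [ i ]≔ u) + D (A [ i ]≔ v) ≡⟨ cong (_+ D (A [ i ]≔ v)) (*-identityˡ _) ⟩
      D (A [ i ]≔ u) + D (A [ i ]≔ v)     ∎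

    zero-row : ∀ A i → D (A [ i ]≔ const 0#) ≡ 0#
    zero-row A i = x+x≈x⇒x≈0 (D (A [ i ]≔ const 0#)) (sym (begin
      D (A [ i ]≔ const 0#)                       ≡⟨ D-cong (≔-cong i (λ _ _ → refl) (λ _ → sym 1*0+0≡0)) ⟩
      D (A [ i ]≔ (λ _ → 1# * 0# + 0#))           ≡⟨ linear A i 1# (const 0#) (const 0#) ⟩
      1# * D (A [ i ]≔ const 0#) + D (A [ i ]≔ const 0#) ≡⟨ cong (_+ D (A [ i ]≔ const 0#)) (*-identityˡ _) ⟩
      D (A [ i ]≔ const 0#) + D (A [ i ]≔ const 0#) ∎))
      where
      1*0+0≡0 : 1# * 0# + 0# ≡ 0#
      1*0+0≡0 = trans (+-identityʳ (1# * 0#)) (zeroʳ 1#)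

    sum-linear : ∀ {p} A i (c : Vector R p) (V : Mat p n) →
                 D (A [ i ]≔ (λ k → sum (λ j → c j * V j k))) ≡ sum (λ j → c j * D (A [ i ]≔ V j))
    sum-linear {zero}  A i c V = zero-row A i
    sum-linear {suc p} A i c V = begin
      D (A [ i ]≔ (λ k → c zero * V zero k + rest k))              ≡⟨ linear A i (c zero) (V zero) rest ⟩
      c zero * D (A [ i ]≔ V zero) + D (A [ i ]≔ rest)
        ≡⟨ cong (c zero * D (A [ i ]≔ V zero) +_) (sum-linear A i (c ∘ suc) (V ∘ suc)) ⟩
      c zero * D (A [ i ]≔ V zero) + sum (λ j → c (suc j) * D (A [ i ]≔ V (suc j))) ∎
      where
      rest : Vector R n
      rest k = sum (λ j → c (suc j) * V (suc j) k)

    expand-row : ∀ A i → D A ≡ sum (λ j → A i j * D (A [ i ]≔ I j))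
    expand-row A i = begin
      D A                                             ≡⟨ D-cong (λ a k → trans (sym (≔-self A i a k)) (≔-cong i (λ _ _ → refl) Aᵢ≡ a k)) ⟩
      D (A [ i ]≔ (λ k → sum (λ j → A i j * I j k))) ≡⟨ sum-linear A i (A i) I ⟩
      sum (λ j → A i j * D (A [ i ]≔ I j))            ∎
      where
      Aᵢ≡ : ∀ k → A i k ≡ sum (λ j → A i j * I j k)
      Aᵢ≡ k = sym (sum-δʳ k (A i))

    swap : ∀ A {i j} → i ≢ j → (∀ B → B i ≗ B j → D B ≡ 0#) → D ((A [ i ]≔ A j) [ j ]≔ A i) ≡ - D A
    swap A {i} {j} i≢j alt = begin
      S (A j) (A i)   ≡⟨ +-inverseʳ-unique (S (A i) (A j)) (S (A j) (A i)) cancel ⟩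
      - S (A i) (A j) ≡⟨ cong -_ (D-cong unchanged) ⟩
      - D A           ∎
      where
      S : Vector R n → Vector R n → R
      S x y = D ((A [ i ]≔ x) [ j ]≔ y)

      S-diag : ∀ w → S w w ≡ 0#
      S-diag w = alt _ (λ k → trans (cong-app (trans (≔-minimal _ w i≢j) (≔-updates A i w)) k)
                                     (sym (cong-app (≔-updates _ j w) k)))

      S-addˡ : ∀ u v y → S (λ k → u k + v k) y ≡ S u y + S v y
      S-addˡ u v y = begin
        S (λ k → u k + v k) y                                 ≡⟨ D-cong (≔-comm A _ y i≢j) ⟩
        D ((A [ j ]≔ y) [ i ]≔ (λ k → u k + v k))             ≡⟨ additive (A [ j ]≔ y) i u v ⟩
        D ((A [ j ]≔ y) [ i ]≔ u) + D ((A [ j ]≔ y) [ i ]≔ v)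
          ≡⟨ sym (cong₂ _+_ (D-cong (≔-comm A u y i≢j)) (D-cong (≔-comm A v y i≢j))) ⟩
        S u y + S v y                                         ∎

      a b a+b : Vector R n
      a = A i
      b = A j
      a+b k = a k + b k

      cancel : S a b + S b a ≡ 0#
      cancel = begin
        S a b + S b a                     ≡⟨ sym (cong₂ _+_ (+-identityˡ (S a b)) (+-identityʳ (S b a))) ⟩
        (0# + S a b) + (S b a + 0#)       ≡⟨ sym (cong₂ (λ p q → (p + S a b) + (S b a + q)) (S-diag a) (S-diag b)) ⟩
        (S a a + S a b) + (S b a + S b b) ≡⟨ sym (cong₂ _+_ (additive (A [ i ]≔ a) j a b) (additive (A [ i ]≔ b) j a b)) ⟩
        S a a+b + S b a+b                 ≡⟨ sym (S-addˡ a b a+b) ⟩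
        S a+b a+b                         ≡⟨ S-diag a+b ⟩
        0#                                ∎

      unchanged : (A [ i ]≔ A i) [ j ]≔ A j ≋ A
      unchanged p k = trans (≔-cong j (≔-self A i) (λ _ → refl) p k) (≔-self A j p k)

  record IsAlternating {m n} (D : Mat m n → R) : Set where
    field
      isMultilinear : IsMultilinear D
      alternating   : ∀ A {i j} → i ≢ j → A i ≗ A j → D A ≡ 0#

    open IsMultilinear isMultilinear public

    swap-rows : ∀ A {i j} → i ≢ j → D ((A [ i ]≔ A j) [ j ]≔ A i) ≡ - D A
    swap-rows A i≢j = swap A i≢j (λ B → alternating B i≢j)

    row-combination : ∀ A i (c : Vector R m) → D (A [ i ]≔ (λ k → sum (λ j → c j * A j k))) ≡ c i * D A
    row-combination A i c = begin
      D (A [ i ]≔ (λ k → sum (λ j → c j * A j k))) ≡⟨ sum-linear A i c A ⟩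
      sum (λ j → c j * D (A [ i ]≔ A j))          ≡⟨ sum-single i vanishing ⟩
      c i * D (A [ i ]≔ A i)                      ≡⟨ cong (c i *_) (D-cong (≔-self A i)) ⟩
      c i * D A                                   ∎
      where
      vanishing : ∀ j → j ≢ i → c j * D (A [ i ]≔ A j) ≡ 0#
      vanishing j j≢i = trans (cong (c j *_) (alternating _ (j≢i ∘ sym) (λ k →
        trans (cong-app (≔-updates A i (A j)) k) (sym (cong-app (≔-minimal A (A j) j≢i) k))))) (zeroʳ (c j))

  ≔-map : ∀ {m p n} (L : Vector R p → Vector R n) (V : Mat m p) i w →
          (λ a → L ((V [ i ]≔ w) a)) ≋ (λ a → L (V a)) [ i ]≔ L w
  ≔-map L V i w a k with a ≟ i
  ... | yes refl = trans (cong (λ r → L r k) (≔-updates V a w)) (sym (cong-app (≔-updates (L ∘ V) a (L w)) k))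
  ... | no a≢i   = trans (cong (λ r → L r k) (≔-minimal V w a≢i)) (sym (cong-app (≔-minimal (L ∘ V) (L w) a≢i) k))

  ∷-cong : ∀ {m n} {a b : Vector R n} {V W : Mat m n} → a ≗ b → V ≋ W → a ∷ V ≋ b ∷ W
  ∷-cong a≗b V≋W zero    = a≗b
  ∷-cong a≗b V≋W (suc i) = V≋W i

  ∷-η : ∀ {m n} (A : Mat (suc m) n) → A zero ∷ (A ∘ suc) ≋ A
  ∷-η A zero    k = refl
  ∷-η A (suc i) k = refl

  ≔-head : ∀ {m n} (V : Mat (suc m) n) u → V [ zero ]≔ u ≋ u ∷ (V ∘ suc)
  ≔-head V u zero    k = refl
  ≔-head V u (suc i) k = refl

  ∷-≔ : ∀ {m n} (a : Vector R n) (V : Mat m n) i u → a ∷ (V [ i ]≔ u) ≋ (a ∷ V) [ suc i ]≔ u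
  ∷-≔ a V i u zero    k = refl
  ∷-≔ a V i u (suc j) k = refl

  ∷-multilinear : ∀ {m n} {D : Mat (suc m) n → R} → IsMultilinear D → ∀ a → IsMultilinear (λ V → D (a ∷ V))
  ∷-multilinear {D = D} D-ml a = record
    { D-cong = λ V≋W → D-cong (∷-cong (λ _ → refl) V≋W)
    ; linear = λ V i c u v → begin
        D (a ∷ (V [ i ]≔ (λ k → c * u k + v k)))                ≡⟨ D-cong (∷-≔ a V i _) ⟩
        D ((a ∷ V) [ suc i ]≔ (λ k → c * u k + v k))           ≡⟨ linear (a ∷ V) (suc i) c u v ⟩
        c * D ((a ∷ V) [ suc i ]≔ u) + D ((a ∷ V) [ suc i ]≔ v)
          ≡⟨ sym (cong₂ (λ p q → c * p + q) (D-cong (∷-≔ a V i u)) (D-cong (∷-≔ a V i v))) ⟩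
        c * D (a ∷ (V [ i ]≔ u)) + D (a ∷ (V [ i ]≔ v))         ∎
    }
    where open IsMultilinear D-ml

  ∷-alternating : ∀ {m n} {D : Mat (suc m) n → R} → IsAlternating D → ∀ a → IsAlternating (λ V → D (a ∷ V))
  ∷-alternating D-alt a = record
    { isMultilinear = ∷-multilinear isMultilinear a
    ; alternating   = λ V i≢j Vi≗Vj → alternating (a ∷ V) (i≢j ∘ suc-injective) Vi≗Vj
    }
    where open IsAlternating D-alt

  map-alternating : ∀ {m p n} {D : Mat m n → R} → IsAlternating D →
    (L : Vector R p → Vector R n) → (∀ {u v} → u ≗ v → L u ≗ L v) →
    (∀ c u v k → L (λ k → c * u k + v k) k ≡ c * L u k + L v k) →
    IsAlternating (λ (V : Mat m p) → D (λ a → L (V a)))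
  map-alternating {D = D} D-alt L L-cong L-linear = record
    { isMultilinear = record
      { D-cong = λ V≋W → D-cong (λ a → L-cong (V≋W a))
      ; linear = λ V i c u v → begin
          D (λ a → L ((V [ i ]≔ (λ k → c * u k + v k)) a))       ≡⟨ D-cong (≔-map L V i _) ⟩
          D ((L ∘ V) [ i ]≔ L (λ k → c * u k + v k))             ≡⟨ D-cong (≔-cong i (λ _ _ → refl) (L-linear c u v)) ⟩
          D ((L ∘ V) [ i ]≔ (λ k → c * L u k + L v k))           ≡⟨ linear (L ∘ V) i c (L u) (L v) ⟩
          c * D ((L ∘ V) [ i ]≔ L u) + D ((L ∘ V) [ i ]≔ L v)
            ≡⟨ sym (cong₂ (λ p q → c * p + q) (D-cong (≔-map L V i u)) (D-cong (≔-map L V i v))) ⟩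
          c * D (λ a → L ((V [ i ]≔ u) a)) + D (λ a → L ((V [ i ]≔ v) a)) ∎
      }
    ; alternating = λ V i≢j Vi≗Vj → alternating (L ∘ V) i≢j (L-cong Vi≗Vj)
    }
    where open IsAlternating D-alt

  add-multiples : ∀ {m n} {E : Mat m n → R} → IsMultilinear E → (a : Vector R n) →
                  (∀ V i → E (V [ i ]≔ a) ≡ 0#) →
                  ∀ V (c : Vector R m) → E (λ i k → V i k + c i * a k) ≡ E V
  add-multiples {zero}      E-ml a annihilates V c = IsMultilinear.D-cong E-ml (λ ())
  add-multiples {suc m} {E = E} E-ml a annihilates V c = begin
    E (λ i k → V i k + c i * a k)                        ≡⟨ D-cong (λ i k → sym (∷-η (λ i k → V i k + c i * a k) i k)) ⟩
    E (w ∷ (λ i k → V (suc i) k + c (suc i) * a k))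
      ≡⟨ add-multiples (∷-multilinear E-ml w) a annihilates′ (V ∘ suc) (c ∘ suc) ⟩
    E (w ∷ (V ∘ suc))
      ≡⟨ D-cong (λ i k → trans (∷-cong (λ k → +-comm (V zero k) _) (λ _ _ → refl) i k) (sym (≔-head V _ i k))) ⟩
    E (V [ zero ]≔ (λ k → c zero * a k + V zero k))      ≡⟨ linear V zero (c zero) a (V zero) ⟩
    c zero * E (V [ zero ]≔ a) + E (V [ zero ]≔ V zero)
      ≡⟨ cong₂ (λ p q → c zero * p + q) (annihilates V zero) (D-cong (≔-self V zero)) ⟩
    c zero * 0# + E V                                    ≡⟨ cong (_+ E V) (zeroʳ (c zero)) ⟩
    0# + E V                                             ≡⟨ +-identityˡ (E V) ⟩
    E V                                                  ∎
    where
    open IsMultilinear E-ml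
    w : Vector R _
    w k = V zero k + c zero * a k
    annihilates′ : ∀ W i → E (w ∷ (W [ i ]≔ a)) ≡ 0#
    annihilates′ W i = trans (D-cong (∷-≔ w W i a)) (annihilates (w ∷ W) (suc i))

  sign : ℕ → R
  sign zero    = 1#
  sign (suc k) = - sign k

  sign-involutive : ∀ k → sign k * sign k ≡ 1#
  sign-involutive zero    = *-identityˡ 1#
  sign-involutive (suc k) = trans (-x*-y≡x*y (sign k) (sign k)) (sign-involutive k)

  sign-cancel : ∀ k {x y} → sign k * x ≡ sign k * y → x ≡ y
  sign-cancel k {x} {y} eq = begin
    x                      ≡⟨ sym (trans (cong (_* x) (sign-involutive k)) (*-identityˡ x)) ⟩
    (sign k * sign k) * x  ≡⟨ *-assoc (sign k) (sign k) x ⟩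
    sign k * (sign k * x)  ≡⟨ cong (sign k *_) eq ⟩
    sign k * (sign k * y)  ≡⟨ sym (*-assoc (sign k) (sign k) y) ⟩
    (sign k * sign k) * y  ≡⟨ trans (cong (_* y) (sign-involutive k)) (*-identityˡ y) ⟩
    y                      ∎

  rotate : ∀ {m n} {D : Mat (suc m) n → R} → IsAlternating D → (A : Mat (suc m) n) (j : Fin (suc m)) →
           D (A j ∷ (A ∘ punchIn j)) ≡ sign (toℕ j) * D A
  rotate D-alt A zero = trans (IsAlternating.D-cong D-alt (∷-η A))
                              (sym (*-identityˡ _))
  rotate {suc m} {D = D} D-alt A (suc j) = begin
    D (A (suc j) ∷ (A ∘ punchIn (suc j)))                     ≡⟨ D-cong exchanged ⟩
    D ((B [ zero ]≔ B (suc zero)) [ suc zero ]≔ B zero)       ≡⟨ swap-rows B {zero} {suc zero} (λ ()) ⟩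
    - D (A zero ∷ (A (suc j) ∷ (A ∘ suc ∘ punchIn j)))
      ≡⟨ cong -_ (rotate (∷-alternating D-alt (A zero)) (A ∘ suc) j) ⟩
    - (sign (toℕ j) * D (A zero ∷ (A ∘ suc)))                 ≡⟨ cong (λ z → - (sign (toℕ j) * z)) (D-cong (∷-η A)) ⟩
    - (sign (toℕ j) * D A)                                    ≡⟨ -‿distribˡ-* (sign (toℕ j)) (D A) ⟩
    - sign (toℕ j) * D A                                      ∎
    where
    open IsAlternating D-alt
    B : Mat (suc (suc m)) _
    B = A zero ∷ (A (suc j) ∷ (A ∘ suc ∘ punchIn j))
    exchanged : A (suc j) ∷ (A ∘ punchIn (suc j)) ≋ (B [ zero ]≔ B (suc zero)) [ suc zero ]≔ B zero
    exchanged zero          k = refl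
    exchanged (suc zero)    k = refl
    exchanged (suc (suc i)) k = refl

  add-row-multiples : ∀ {m n} {D : Mat m n → R} → IsAlternating D → ∀ (A : Mat m n) b (c : Vector R m) →
                      c b ≡ 0# → D (λ i k → A i k + c i * A b k) ≡ D A
  add-row-multiples {suc m} {D = D} D-alt A b c cb≡0 = sign-cancel (toℕ b) (begin
    sign (toℕ b) * D A′                                         ≡⟨ sym (rotate D-alt A′ b) ⟩
    D (A′ b ∷ (A′ ∘ punchIn b))                                 ≡⟨ D-cong (∷-cong row-b (λ _ _ → refl)) ⟩
    D (A b ∷ (λ i k → A (punchIn b i) k + c (punchIn b i) * A b k))
      ≡⟨ add-multiples (∷-multilinear isMultilinear (A b)) (A b) annihilates (A ∘ punchIn b) (c ∘ punchIn b) ⟩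
    D (A b ∷ (A ∘ punchIn b))                                   ≡⟨ rotate D-alt A b ⟩
    sign (toℕ b) * D A                                          ∎)
    where
    open IsAlternating D-alt
    A′ : Mat (suc m) _
    A′ i k = A i k + c i * A b k
    row-b : A′ b ≗ A b
    row-b k = trans (cong (λ z → A b k + z * A b k) cb≡0) (trans (cong (A b k +_) (zeroˡ (A b k))) (+-identityʳ (A b k)))
    annihilates : ∀ V i → D (A b ∷ (V [ i ]≔ A b)) ≡ 0#
    annihilates V i = alternating (A b ∷ (V [ i ]≔ A b)) {zero} {suc i} (λ ()) (λ k → sym (cong-app (≔-updates V i (A b)) k))

  minor : ∀ {n} → Mat (suc n) (suc n) → Fin (suc n) → Mat n n
  minor A j i k = A (suc i) (punchIn j k)

  Det : ∀ n → Mat n n → R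
  Det zero    A = 1#
  Det (suc n) A = sum (λ j → sign (toℕ j) * (A zero j * Det n (minor A j)))

  -- Det respects entrywise equality and is linear in each row: the first row enters the
  -- expansion linearly, the other rows through the minors.
  Det-cong : ∀ n {A B : Mat n n} → A ≋ B → Det n A ≡ Det n B
  Det-cong zero    A≋B = refl
  Det-cong (suc n) A≋B = sum-cong-≗ (λ j → cong₂ (λ p q → sign (toℕ j) * (p * q))
                                        (A≋B zero j) (Det-cong n (λ i k → A≋B (suc i) (punchIn j k))))

  Det-linear : ∀ n A i c u v → Det n (A [ i ]≔ (λ k → c * u k + v k)) ≡ c * Det n (A [ i ]≔ u) + Det n (A [ i ]≔ v)
  Det-linear (suc n) A zero c u v = begin
    sum (λ j → s j * ((c * u j + v j) * M j))                        ≡⟨ sum-cong-≗ (λ j → expand (s j) (u j) (v j) (M j)) ⟩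
    sum (λ j → c * (s j * (u j * M j)) + s j * (v j * M j))
      ≡⟨ sum-combination c (λ j → s j * (u j * M j)) (λ j → s j * (v j * M j)) ⟩
    c * sum (λ j → s j * (u j * M j)) + sum (λ j → s j * (v j * M j)) ∎
    where
    s : Fin (suc n) → R
    s j = sign (toℕ j)
    M : Fin (suc n) → R
    M j = Det n (minor A j)
    expand : ∀ σ x y μ → σ * ((c * x + y) * μ) ≡ c * (σ * (x * μ)) + σ * (y * μ)
    expand σ x y μ = begin
      σ * ((c * x + y) * μ)          ≡⟨ cong (σ *_) (distribʳ μ (c * x) y) ⟩
      σ * ((c * x) * μ + y * μ)      ≡⟨ distribˡ σ _ _ ⟩
      σ * ((c * x) * μ) + σ * (y * μ) ≡⟨ cong (λ z → σ * z + σ * (y * μ)) (*-assoc c x μ) ⟩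
      σ * (c * (x * μ)) + σ * (y * μ) ≡⟨ cong (_+ σ * (y * μ)) (*-leftComm σ c (x * μ)) ⟩
      c * (σ * (x * μ)) + σ * (y * μ) ∎
  Det-linear (suc n) A (suc i) c u v = begin
    sum (λ j → s j * (A zero j * Det n (minor (A [ suc i ]≔ w) j)))
      ≡⟨ sum-cong-≗ (λ j → cong (λ z → s j * (A zero j * z))
                       (trans (Det-cong n (minor-≔ w j)) (Det-linear n (minor A j) i c _ _))) ⟩
    sum (λ j → s j * (A zero j * (c * U j + V j)))
      ≡⟨ sum-cong-≗ (λ j → expand (s j) (A zero j) (U j) (V j)) ⟩
    sum (λ j → c * (s j * (A zero j * U j)) + s j * (A zero j * V j))
      ≡⟨ sum-combination c (λ j → s j * (A zero j * U j)) (λ j → s j * (A zero j * V j)) ⟩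
    c * sum (λ j → s j * (A zero j * U j)) + sum (λ j → s j * (A zero j * V j))
      ≡⟨ sym (cong₂ (λ p q → c * p + q) (sum-cong-≗ (λ j → cong (λ z → s j * (A zero j * z)) (Det-cong n (minor-≔ u j))))
                                       (sum-cong-≗ (λ j → cong (λ z → s j * (A zero j * z)) (Det-cong n (minor-≔ v j))))) ⟩
    c * Det (suc n) (A [ suc i ]≔ u) + Det (suc n) (A [ suc i ]≔ v) ∎
    where
    w : Vector R (suc n)
    w k = c * u k + v k
    s : Fin (suc n) → R
    s j = sign (toℕ j)
    minor-≔ : ∀ x j → minor (A [ suc i ]≔ x) j ≋ minor A j [ i ]≔ (x ∘ punchIn j)
    minor-≔ x j = ≔-map (_∘ punchIn j) (A ∘ suc) i x
    U V : Fin (suc n) → R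
    U j = Det n (minor A j [ i ]≔ (u ∘ punchIn j))
    V j = Det n (minor A j [ i ]≔ (v ∘ punchIn j))
    expand : ∀ σ a x y → σ * (a * (c * x + y)) ≡ c * (σ * (a * x)) + σ * (a * y)
    expand σ a x y = begin
      σ * (a * (c * x + y))           ≡⟨ cong (σ *_) (distribˡ a (c * x) y) ⟩
      σ * (a * (c * x) + a * y)       ≡⟨ distribˡ σ _ _ ⟩
      σ * (a * (c * x)) + σ * (a * y) ≡⟨ cong (λ z → σ * z + σ * (a * y)) (*-leftComm a c x) ⟩
      σ * (c * (a * x)) + σ * (a * y) ≡⟨ cong (_+ σ * (a * y)) (*-leftComm σ c (a * x)) ⟩
      c * (σ * (a * x)) + σ * (a * y) ∎

  antisymmetric-sum : ∀ {n} (F : Fin n → Fin n → R) → (∀ i → F i i ≡ 0#) → (∀ i j → F j i ≡ - F i j) →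
                      sum (λ i → sum (F i)) ≡ 0#
  antisymmetric-sum {zero}  F diag anti = refl
  antisymmetric-sum {suc n} F diag anti = begin
    (F zero zero + row) + sum (λ i → F (suc i) zero + sum (F (suc i) ∘ suc))
      ≡⟨ cong₂ _+_ (cong (_+ row) (diag zero)) (∑-distrib-+ (λ i → F (suc i) zero) (λ i → sum (F (suc i) ∘ suc))) ⟩
    (0# + row) + (sum (λ i → F (suc i) zero) + sum (λ i → sum (F (suc i) ∘ suc)))
      ≡⟨ cong₂ _+_ (+-identityˡ row) (cong₂ _+_ column inner) ⟩
    row + (- row + 0#) ≡⟨ cong (row +_) (+-identityʳ (- row)) ⟩
    row - row          ≡⟨ -‿inverseʳ row ⟩
    0#                 ∎
    where
    row : R
    row = sum (F zero ∘ suc)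
    column : sum (λ i → F (suc i) zero) ≡ - row
    column = trans (sum-cong-≗ (λ i → anti zero (suc i))) (sum-neg (F zero ∘ suc))
    inner : sum (λ i → sum (F (suc i) ∘ suc)) ≡ 0#
    inner = antisymmetric-sum (λ i j → F (suc i) (suc j)) (diag ∘ suc) (λ i j → anti (suc i) (suc j))

  -- Spreading an array T j k (k indexing the positions c ≠ j) over all pairs (j , c).
  offDiagonal : ∀ {n} → (Fin (suc n) → Fin n → R) → Fin (suc n) → Fin (suc n) → R
  offDiagonal T j c with j ≟ c
  ... | yes _  = 0#
  ... | no j≢c = T j (punchOut j≢c)

  offDiagonal-diag : ∀ {n} (T : Fin (suc n) → Fin n → R) j → offDiagonal T j j ≡ 0#
  offDiagonal-diag T j with j ≟ j
  ... | yes _  = refl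
  ... | no j≢j = ⊥-elim (j≢j refl)

  sum-offDiagonal : ∀ {n} (T : Fin (suc n) → Fin n → R) j → sum (offDiagonal T j) ≡ sum (T j)
  sum-offDiagonal T j = begin
    sum (offDiagonal T j)                               ≡⟨ sum-remove {i = j} (offDiagonal T j) ⟩
    offDiagonal T j j + sum (offDiagonal T j ∘ punchIn j) ≡⟨ cong₂ _+_ (offDiagonal-diag T j) (sum-cong-≗ at-punchIn) ⟩
    0# + sum (T j)                                      ≡⟨ +-identityˡ (sum (T j)) ⟩
    sum (T j)                                           ∎
    where
    at-punchIn : ∀ k → offDiagonal T j (punchIn j k) ≡ T j k
    at-punchIn k with j ≟ punchIn j k
    ... | yes j≡jₖ = ⊥-elim (punchInᵢ≢i j k (sym j≡jₖ))
    ... | no _     = cong (T j) (trans (punchOut-cong j refl) (punchOut-punchIn j))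

  offDiagonal-antisymmetric : ∀ {n} (T : Fin (suc n) → Fin n → R) →
    (∀ {c j} (p : c ≢ j) (q : j ≢ c) → T c (punchOut p) ≡ - T j (punchOut q)) →
    ∀ j c → offDiagonal T c j ≡ - offDiagonal T j c
  offDiagonal-antisymmetric T exchange j c with c ≟ j | j ≟ c
  ... | yes _   | yes _   = sym -0#≈0#
  ... | yes c≡j | no j≢c  = ⊥-elim (j≢c (sym c≡j))
  ... | no c≢j  | yes j≡c = ⊥-elim (c≢j (sym j≡c))
  ... | no c≢j  | no j≢c  = exchange c≢j j≢c

  -- Deleting the distinct positions a, b of Fin (suc (suc n)) in either order gives the same embedding.
  punchIn-exchange : ∀ {n} (a b : Fin (suc (suc n))) (p : a ≢ b) (q : b ≢ a) (l : Fin n) →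
                     punchIn a (punchIn (punchOut p) l) ≡ punchIn b (punchIn (punchOut q) l)
  punchIn-exchange zero    zero    p q l = ⊥-elim (p refl)
  punchIn-exchange zero    (suc b) p q l = refl
  punchIn-exchange (suc a) zero    p q l = refl
  punchIn-exchange {suc n} (suc a) (suc b) p q zero    = refl
  punchIn-exchange {suc n} (suc a) (suc b) p q (suc l) = cong suc (punchIn-exchange a b (p ∘ cong suc) (q ∘ cong suc) l)

  sign-exchange : ∀ {n} (a b : Fin (suc (suc n))) (p : a ≢ b) (q : b ≢ a) →
                  sign (toℕ a) * sign (toℕ (punchOut p)) ≡ - (sign (toℕ b) * sign (toℕ (punchOut q)))
  sign-exchange zero    zero    p q = ⊥-elim (p refl)
  sign-exchange zero    (suc b) p q = begin
    1# * sign (toℕ b)        ≡⟨ *-identityˡ _ ⟩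
    sign (toℕ b)             ≡⟨ sym (-‿involutive _) ⟩
    - - sign (toℕ b)         ≡⟨ cong -_ (sym (*-identityʳ _)) ⟩
    - (- sign (toℕ b) * 1#)  ∎
  sign-exchange (suc a) zero    p q = begin
    - sign (toℕ a) * 1#      ≡⟨ *-identityʳ _ ⟩
    - sign (toℕ a)           ≡⟨ cong -_ (sym (*-identityˡ _)) ⟩
    - (1# * sign (toℕ a))    ∎
  sign-exchange {zero}  (suc zero) (suc zero) p q = ⊥-elim (p refl)
  sign-exchange {suc n} (suc a) (suc b) p q = begin
    - sign (toℕ a) * - sign (toℕ (punchOut p′))        ≡⟨ -x*-y≡x*y _ _ ⟩
    sign (toℕ a) * sign (toℕ (punchOut p′))            ≡⟨ sign-exchange a b p′ q′ ⟩
    - (sign (toℕ b) * sign (toℕ (punchOut q′)))        ≡⟨ cong -_ (sym (-x*-y≡x*y _ _)) ⟩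
    - (- sign (toℕ b) * - sign (toℕ (punchOut q′)))    ∎
    where
    p′ = p ∘ cong suc
    q′ = q ∘ cong suc

  -- Expanding along the first two rows: if they agree, the terms cancel in pairs.
  Det-equal-first-rows : ∀ n (A : Mat (suc (suc n)) (suc (suc n))) → A zero ≗ A (suc zero) →
                         Det (suc (suc n)) A ≡ 0#
  Det-equal-first-rows n A A₀≗A₁ = begin
    Det (suc (suc n)) A               ≡⟨ sum-cong-≗ expand-second-row ⟩
    sum (λ j → sum (T j))             ≡⟨ sym (sum-cong-≗ (sum-offDiagonal T)) ⟩
    sum (λ j → sum (offDiagonal T j))
      ≡⟨ antisymmetric-sum (offDiagonal T) (offDiagonal-diag T) (offDiagonal-antisymmetric T exchange) ⟩
    0#                                ∎
    where
    s : ∀ {k} → Fin k → R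
    s j = sign (toℕ j)
    Δ : Fin (suc (suc n)) → Fin (suc n) → R
    Δ j k = Det n (λ i l → A (suc (suc i)) (punchIn j (punchIn k l)))
    T : Fin (suc (suc n)) → Fin (suc n) → R
    T j k = s j * (A zero j * (s k * (A (suc zero) (punchIn j k) * Δ j k)))

    expand-second-row : ∀ j → s j * (A zero j * Det (suc n) (minor A j)) ≡ sum (T j)
    expand-second-row j = trans (cong (s j *_) (*-distribˡ-sum (A zero j) (λ k → s k * (A (suc zero) (punchIn j k) * Δ j k))))
                                (*-distribˡ-sum (s j) (λ k → A zero j * (s k * (A (suc zero) (punchIn j k) * Δ j k))))

    regroup : ∀ x y z w → x * (y * (z * w)) ≡ (x * z) * (y * w)
    regroup x y z w = trans (cong (x *_) (*-leftComm y z w)) (sym (*-assoc x z (y * w)))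

    exchange : ∀ {c j} (p : c ≢ j) (q : j ≢ c) → T c (punchOut p) ≡ - T j (punchOut q)
    exchange {c} {j} p q = begin
      s c * (A zero c * (s (punchOut p) * (A (suc zero) (punchIn c (punchOut p)) * Δ c (punchOut p))))
        ≡⟨ cong (λ z → s c * (A zero c * (s (punchOut p) * z))) (cong₂ _*_ A₁c′≡A₀j Δ-exchange) ⟩
      s c * (A zero c * (s (punchOut p) * (A zero j * Δ′)))      ≡⟨ regroup _ _ _ _ ⟩
      (s c * s (punchOut p)) * (A zero c * (A zero j * Δ′))      ≡⟨ cong₂ _*_ (sign-exchange c j p q) (*-leftComm _ _ _) ⟩
      - (s j * s (punchOut q)) * (A zero j * (A zero c * Δ′))    ≡⟨ sym (-‿distribˡ-* _ _) ⟩
      - ((s j * s (punchOut q)) * (A zero j * (A zero c * Δ′)))  ≡⟨ cong -_ (sym (regroup _ _ _ _)) ⟩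
      - (s j * (A zero j * (s (punchOut q) * (A zero c * Δ′))))
        ≡⟨ cong (λ z → - (s j * (A zero j * (s (punchOut q) * (z * Δ′))))) A₀c≡A₁j′ ⟩
      - (s j * (A zero j * (s (punchOut q) * (A (suc zero) (punchIn j (punchOut q)) * Δ′)))) ∎
      where
      Δ′ : R
      Δ′ = Δ j (punchOut q)
      Δ-exchange : Δ c (punchOut p) ≡ Δ′
      Δ-exchange = Det-cong n (λ i l → cong (A (suc (suc i))) (punchIn-exchange c j p q l))
      A₁c′≡A₀j : A (suc zero) (punchIn c (punchOut p)) ≡ A zero j
      A₁c′≡A₀j = trans (cong (A (suc zero)) (punchIn-punchOut p)) (sym (A₀≗A₁ j))
      A₀c≡A₁j′ : A zero c ≡ A (suc zero) (punchIn j (punchOut q))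
      A₀c≡A₁j′ = trans (A₀≗A₁ c) (cong (A (suc zero)) (sym (punchIn-punchOut q)))

  Det-multilinear : ∀ n → IsMultilinear (Det n)
  Det-multilinear n = record { D-cong = Det-cong n ; linear = Det-linear n }

  DetAlternating : ℕ → Set
  DetAlternating n = ∀ (A : Mat n n) {i j} → i ≢ j → A i ≗ A j → Det n A ≡ 0#

  -- two equal rows below the first: each minor has two equal rows
  Det-equal-lower-rows : ∀ {n} → DetAlternating n → ∀ (A : Mat (suc n) (suc n)) {i j : Fin n} → i ≢ j →
                         A (suc i) ≗ A (suc j) → Det (suc n) A ≡ 0#
  Det-equal-lower-rows alt A i≢j Aᵢ≗Aⱼ = sum-zero (λ l →
    trans (cong (λ z → sign (toℕ l) * (A zero l * z)) (alt (minor A l) i≢j (Aᵢ≗Aⱼ ∘ punchIn l)))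
          (trans (cong (sign (toℕ l) *_) (zeroʳ (A zero l))) (zeroʳ (sign (toℕ l)))))

  -- the first row equal to row suc j: exchanging rows 1 and suc j reduces this to Det-equal-first-rows
  Det-equal-first-row : ∀ {n} → DetAlternating n → ∀ (A : Mat (suc n) (suc n)) (j : Fin n) →
                        A zero ≗ A (suc j) → Det (suc n) A ≡ 0#
  Det-equal-first-row {suc n} alt A zero    A₀≗A₁ = Det-equal-first-rows n A A₀≗A₁
  Det-equal-first-row {suc n} alt A (suc j) A₀≗Aⱼ = begin
    Det (suc (suc n)) A      ≡⟨ sym (-‿involutive _) ⟩
    - - Det (suc (suc n)) A  ≡⟨ cong -_ (sym exchanged) ⟩
    - Det (suc (suc n)) B    ≡⟨ cong -_ (Det-equal-first-rows n B A₀≗Aⱼ) ⟩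
    - 0#                     ≡⟨ -0#≈0# ⟩
    0#                       ∎
    where
    B : Mat (suc (suc n)) (suc (suc n))
    B = (A [ suc zero ]≔ A (suc (suc j))) [ suc (suc j) ]≔ A (suc zero)
    exchanged : Det (suc (suc n)) B ≡ - Det (suc (suc n)) A
    exchanged = IsMultilinear.swap (Det-multilinear (suc (suc n))) A {suc zero} {suc (suc j)} (λ ())
                  (λ C → Det-equal-lower-rows alt C {zero} {suc j} (λ ()))

  Det-alternating : ∀ n → DetAlternating n
  Det-alternating (suc n) A {zero}  {zero}  0≢0 _ = ⊥-elim (0≢0 refl)
  Det-alternating (suc n) A {zero}  {suc j} _ A₀≗Aⱼ = Det-equal-first-row (Det-alternating n) A j A₀≗Aⱼ
  Det-alternating (suc n) A {suc i} {zero}  _ Aᵢ≗A₀ = Det-equal-first-row (Det-alternating n) A i (λ k → sym (Aᵢ≗A₀ k))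
  Det-alternating (suc n) A {suc i} {suc j} i≢j Aᵢ≗Aⱼ = Det-equal-lower-rows (Det-alternating n) A (i≢j ∘ cong suc) Aᵢ≗Aⱼ

  Det-isAlternating : ∀ n → IsAlternating (Det n)
  Det-isAlternating n = record { isMultilinear = Det-multilinear n ; alternating = Det-alternating n }

  insert-cong : ∀ {n} (j : Fin (suc n)) {u v : Vector R n} → u ≗ v → insertAt u j 0# ≗ insertAt v j 0#
  insert-cong j {u} {v} u≗v = ≗-split j
    (trans (insertAt-lookup u j 0#) (sym (insertAt-lookup v j 0#)))
    (λ l → trans (insertAt-punchIn u j 0# l) (trans (u≗v l) (sym (insertAt-punchIn v j 0# l))))

  insert-linear : ∀ {n} (j : Fin (suc n)) c (u v : Vector R n) k →
                  insertAt (λ k → c * u k + v k) j 0# k ≡ c * insertAt u j 0# k + insertAt v j 0# k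
  insert-linear j c u v = ≗-split j
    (trans (insertAt-lookup _ j 0#) (sym (trans (cong₂ (λ p q → c * p + q) (insertAt-lookup u j 0#) (insertAt-lookup v j 0#))
                                              (trans (+-identityʳ (c * 0#)) (zeroʳ c)))))
    (λ l → trans (insertAt-punchIn _ j 0# l)
                 (sym (cong₂ (λ p q → c * p + q) (insertAt-punchIn u j 0# l) (insertAt-punchIn v j 0# l))))

  insert-δ : ∀ {n} (j : Fin (suc n)) (i : Fin n) → insertAt (δ i) j 0# ≗ δ (punchIn j i)
  insert-δ j i = ≗-split j
    (trans (insertAt-lookup (δ i) j 0#) (sym (δ-off (punchInᵢ≢i j i))))
    (λ l → trans (insertAt-punchIn (δ i) j 0# l) (sym (δ-punchIn j i l)))

  insert-split : ∀ {n} (j : Fin (suc n)) (r : Vector R (suc n)) → r ≗ (λ k → insertAt (r ∘ punchIn j) j 0# k + r j * δ j k)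
  insert-split j r = ≗-split j
    (sym (trans (cong₂ _+_ (insertAt-lookup (r ∘ punchIn j) j 0#) (cong (r j *_) (δ-diag j)))
                (trans (+-identityˡ (r j * 1#)) (*-identityʳ (r j)))))
    (λ l → sym (trans (cong₂ _+_ (insertAt-punchIn (r ∘ punchIn j) j 0# l) (cong (r j *_) (δ-off (punchInᵢ≢i j l ∘ sym))))
                      (trans (cong (r (punchIn j l) +_) (zeroʳ (r j))) (+-identityʳ (r (punchIn j l))))))

  alternating-form-unique : ∀ n {D : Mat n n → R} → IsAlternating D → ∀ C → D C ≡ Det n C * D I
  alternating-form-unique zero    D-alt C = trans (IsAlternating.D-cong D-alt (λ ())) (sym (*-identityˡ _))
  alternating-form-unique (suc n) {D} D-alt C = begin
    D C                                                            ≡⟨ expand-row C zero ⟩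
    sum (λ j → C zero j * D (C [ zero ]≔ I j))
      ≡⟨ sum-cong-≗ (λ j → cong (C zero j *_) (unit-first-row j)) ⟩
    sum (λ j → C zero j * (sign (toℕ j) * (Det n (minor C j) * D I)))
      ≡⟨ sum-cong-≗ (λ j → regroup (C zero j) (sign (toℕ j)) (Det n (minor C j)) (D I)) ⟩
    sum (λ j → sign (toℕ j) * (C zero j * Det n (minor C j)) * D I)
      ≡⟨ sym (*-distribʳ-sum (D I) (λ j → sign (toℕ j) * (C zero j * Det n (minor C j)))) ⟩
    Det (suc n) C * D I                                            ∎
    where
    open IsAlternating D-alt
    regroup : ∀ a σ μ d → a * (σ * (μ * d)) ≡ σ * (a * μ) * d
    regroup a σ μ d = trans (*-leftComm a σ (μ * d)) (trans (cong (σ *_) (sym (*-assoc a μ d))) (sym (*-assoc σ (a * μ) d)))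

    -- with e_j in the first row, clearing column j of the other rows leaves the minor
    unit-first-row : ∀ j → D (C [ zero ]≔ I j) ≡ sign (toℕ j) * (Det n (minor C j) * D I)
    unit-first-row j = begin
      D (C [ zero ]≔ I j)
        ≡⟨ D-cong (λ i k → trans (≔-head C (I j) i k) (∷-cong (λ _ → refl) (λ i → insert-split j (C (suc i))) i k)) ⟩
      D (I j ∷ (λ i k → V i k + C (suc i) j * I j k))
        ≡⟨ add-multiples (∷-multilinear isMultilinear (I j)) (I j) annihilates V (λ i → C (suc i) j) ⟩
      D (I j ∷ V)                                             ≡⟨ alternating-form-unique n Dⱼ-alt (minor C j) ⟩
      Det n (minor C j) * D (I j ∷ (λ i → insertAt (I i) j 0#))
        ≡⟨ cong (Det n (minor C j) *_) (D-cong (∷-cong (λ _ → refl) (λ i → insert-δ j i))) ⟩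
      Det n (minor C j) * D (I j ∷ (I ∘ punchIn j))            ≡⟨ cong (Det n (minor C j) *_) (rotate D-alt I j) ⟩
      Det n (minor C j) * (sign (toℕ j) * D I)                ≡⟨ *-leftComm _ _ _ ⟩
      sign (toℕ j) * (Det n (minor C j) * D I)                ∎
      where
      V : Mat n (suc n)
      V i = insertAt (minor C j i) j 0#
      annihilates : ∀ W i → D (I j ∷ (W [ i ]≔ I j)) ≡ 0#
      annihilates W i = alternating (I j ∷ (W [ i ]≔ I j)) {zero} {suc i} (λ ()) (λ k → sym (cong-app (≔-updates W i (I j)) k))
      Dⱼ-alt : IsAlternating (λ (T : Mat n n) → D (I j ∷ (λ i → insertAt (T i) j 0#)))
      Dⱼ-alt = map-alternating (∷-alternating D-alt (I j)) (λ w → insertAt w j 0#) (insert-cong j) (insert-linear j)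

  Det-· : ∀ n (C A : Mat n n) → Det n (C · A) ≡ Det n C * Det n A
  Det-· n C A = trans (alternating-form-unique n form C) (cong (Det n C *_) (Det-cong n (λ i k → sum-δˡ i (λ j → A j k))))
    where
    L : Vector R n → Vector R n
    L w k = sum (λ l → w l * A l k)
    L-linear : ∀ c u v k → L (λ k → c * u k + v k) k ≡ c * L u k + L v k
    L-linear c u v k = trans (sum-cong-≗ (λ l → trans (distribʳ (A l k) (c * u l) (v l))
                                                      (cong (_+ v l * A l k) (*-assoc c (u l) (A l k)))))
                             (sum-combination c (λ l → u l * A l k) (λ l → v l * A l k))
    form : IsAlternating (λ (V : Mat n n) → Det n (V · A))
    form = map-alternating (Det-isAlternating n) L (λ u≗v k → sum-cong-≗ (λ l → cong (_* A l k) (u≗v l))) L-linear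

  Det-I : ∀ n → Det n I ≡ 1#
  Det-I zero    = refl
  Det-I (suc n) = begin
    sum (λ j → sign (toℕ j) * (δ zero j * Det n (minor I j))) ≡⟨ sum-single zero off-zero ⟩
    1# * (δ₀₀ * Det n (minor I zero))                         ≡⟨ *-identityˡ _ ⟩
    δ₀₀ * Det n (minor I zero)
      ≡⟨ cong₂ _*_ (δ-diag {suc n} zero) (Det-cong n (δ-punchIn zero)) ⟩
    1# * Det n I                                              ≡⟨ *-identityˡ _ ⟩
    Det n I                                                   ≡⟨ Det-I n ⟩
    1#                                                        ∎
    where
    δ₀₀ : R
    δ₀₀ = δ {suc n} zero zero
    off-zero : ∀ j → j ≢ zero → sign (toℕ j) * (δ zero j * Det n (minor I j)) ≡ 0#
    off-zero j j≢0 = trans (cong (λ z → sign (toℕ j) * (z * Det n (minor I j))) (δ-off (j≢0 ∘ sym)))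
                           (trans (cong (sign (toℕ j) *_) (zeroˡ _)) (zeroʳ _))

  Det-zero-column : ∀ n (A : Mat n n) b → (∀ i → A i b ≡ 0#) → Det n A ≡ 0#
  Det-zero-column (suc n) A b column≡0 = sum-zero term≡0
    where
    term≡0 : ∀ j → sign (toℕ j) * (A zero j * Det n (minor A j)) ≡ 0#
    term≡0 j with j ≟ b
    ... | yes refl = trans (cong (λ z → sign (toℕ j) * (z * Det n (minor A j))) (column≡0 zero))
                           (trans (cong (sign (toℕ j) *_) (zeroˡ _)) (zeroʳ _))
    ... | no j≢b   = trans (cong (λ z → sign (toℕ j) * (A zero j * z))
                                 (Det-zero-column n (minor A j) (punchOut j≢b)
                                   (λ i → trans (cong (A (suc i)) (punchIn-punchOut j≢b)) (column≡0 (suc i)))))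
                           (trans (cong (sign (toℕ j) *_) (zeroʳ _)) (zeroʳ _))

  -- A square matrix with a nonzero vector ψ in its kernel (normalised by ψ_b = 1) is singular:
  -- multiplying by the identity with column b replaced by ψ produces a zero column.
  Det-kernel : ∀ n (P : Mat n n) (ψ : Vector R n) b → ψ b ≡ 1# → (∀ i → sum (λ l → P i l * ψ l) ≡ 0#) → Det n P ≡ 0#
  Det-kernel n P ψ b ψ_b≡1 Pψ≡0 = begin
    Det n P                ≡⟨ sym (*-identityʳ (Det n P)) ⟩
    Det n P * 1#           ≡⟨ cong (Det n P *_) (sym Det-K≡1) ⟩
    Det n P * Det n K      ≡⟨ sym (Det-· n P K) ⟩
    Det n (P · K)
      ≡⟨ Det-zero-column n (P · K) b (λ i → trans (sum-cong-≗ (λ l → cong (P i l *_) (K-column-b l))) (Pψ≡0 i)) ⟩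
    0#                     ∎
    where
    c : Vector R n
    c l = ψ l - δ l b
    K : Mat n n
    K l k = δ l k + c l * δ b k
    K-column-b : ∀ l → K l b ≡ ψ l
    K-column-b l = begin
      δ l b + (ψ l - δ l b) * δ b b ≡⟨ cong (λ z → δ l b + (ψ l - δ l b) * z) (δ-diag b) ⟩
      δ l b + (ψ l - δ l b) * 1#    ≡⟨ cong (δ l b +_) (*-identityʳ _) ⟩
      δ l b + (ψ l - δ l b)         ≡⟨ x+[y-x]≡y (δ l b) (ψ l) ⟩
      ψ l                           ∎
    Det-K≡1 : Det n K ≡ 1#
    Det-K≡1 = trans (add-row-multiples (Det-isAlternating n) I b c c-b≡0) (Det-I n)
      where
      c-b≡0 : c b ≡ 0#
      c-b≡0 = trans (cong₂ _-_ ψ_b≡1 (δ-diag b)) (-‿inverseʳ 1#)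

  Det-annihilates-relations : ∀ n (A : Mat n n) (c : Vector R n) → (∀ k → sum (λ j → c j * A j k) ≡ 0#) →
                              ∀ i → c i * Det n A ≡ 0#
  Det-annihilates-relations n A c relation i = begin
    c i * Det n A                                       ≡⟨ sym (row-combination A i c) ⟩
    Det n (A [ i ]≔ (λ k → sum (λ j → c j * A j k)))    ≡⟨ Det-cong n (≔-cong i (λ _ _ → refl) relation) ⟩
    Det n (A [ i ]≔ const 0#)                           ≡⟨ zero-row A i ⟩
    0#                                                  ∎
    where open IsAlternating (Det-isAlternating n)

  B-matrix : ∀ {n} → Vector R (suc n) → Mat (suc n) (suc n)
  B-matrix x = x ∷ (λ k l → δ (suc k) l - δ zero l)

  Det-B-matrix : ∀ n (x : Vector R (suc n)) → Det (suc n) (B-matrix x) ≡ sum x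
  Det-B-matrix n x = begin
    Det (suc n) (B-matrix x)                                  ≡⟨ expand-row (B-matrix x) zero ⟩
    sum (λ j → x j * Det (suc n) (B-matrix x [ zero ]≔ I j))
      ≡⟨ sum-cong-≗ (λ j → trans (cong (x j *_) (unit-first-row j)) (*-identityʳ (x j))) ⟩
    sum x                                                     ∎
    where
    open IsAlternating (Det-isAlternating (suc n))
    rows : Mat n (suc n)
    rows k l = δ (suc k) l - δ zero l
    -- e_0 ∷ rows arises from I by subtracting row 0 from the others
    e₀-first-row : Det (suc n) (I zero ∷ rows) ≡ 1#
    e₀-first-row = begin
      Det (suc n) (I zero ∷ rows)                        ≡⟨ Det-cong (suc n) lower-rows ⟩
      Det (suc n) (λ i k → I i k + c i * I zero k)       ≡⟨ add-row-multiples (Det-isAlternating (suc n)) I zero c refl ⟩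
      Det (suc n) I                                      ≡⟨ Det-I (suc n) ⟩
      1#                                                 ∎
      where
      c : Vector R (suc n)
      c zero    = 0#
      c (suc k) = - 1#
      lower-rows : I zero ∷ rows ≋ (λ i k → I i k + c i * I zero k)
      lower-rows zero    l = sym (trans (cong (δ zero l +_) (zeroˡ _)) (+-identityʳ _))
      lower-rows (suc k) l = cong (δ (suc k) l +_) (sym (trans (sym (-‿distribˡ-* 1# (δ zero l)))
                                                                (cong -_ (*-identityˡ (δ zero l)))))
    unit-first-row : ∀ j → Det (suc n) (B-matrix x [ zero ]≔ I j) ≡ 1#
    unit-first-row zero    = e₀-first-row
    unit-first-row (suc k) = begin
      Det (suc n) (I (suc k) ∷ rows)
        ≡⟨ Det-cong (suc n) (∷-cong {V = rows} {W = rows} e_k+1 (λ _ _ → refl)) ⟩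
      Det (suc n) (B-matrix x [ zero ]≔ (λ l → I zero l + rows k l)) ≡⟨ additive (B-matrix x) zero (I zero) (rows k) ⟩
      Det (suc n) (I zero ∷ rows) + Det (suc n) (rows k ∷ rows)
        ≡⟨ cong₂ _+_ e₀-first-row (alternating (rows k ∷ rows) {zero} {suc k} (λ ()) (λ _ → refl)) ⟩
      1# + 0#                                             ≡⟨ +-identityʳ 1# ⟩
      1#                                                  ∎
      where
      e_k+1 : I (suc k) ≗ (λ l → I zero l + rows k l)
      e_k+1 l = sym (x+[y-x]≡y (δ zero l) (δ (suc k) l))

  B-column-zero : ∀ {n} (x y : Vector R (suc n)) → sum (λ j → y j * B-matrix x j zero) ≡ y zero * x zero - sum (y ∘ suc)
  B-column-zero {n} x y = cong (y zero * x zero +_) (trans (sum-cong-≗ term) (sum-neg (y ∘ suc)))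
    where
    δ₀₀ : R
    δ₀₀ = δ {suc n} zero zero
    term : ∀ k → y (suc k) * (δ (suc k) zero - δ₀₀) ≡ - y (suc k)
    term k = begin
      y (suc k) * (δ (suc k) zero - δ₀₀) ≡⟨ cong (λ z → y (suc k) * (z - δ₀₀)) (δ-off {i = suc k} {zero} (λ ())) ⟩
      y (suc k) * (0# - δ₀₀)
        ≡⟨ cong (y (suc k) *_) (trans (+-identityˡ (- δ₀₀)) (cong -_ (δ-diag {suc n} zero))) ⟩
      y (suc k) * - 1#                   ≡⟨ sym (-‿distribʳ-* (y (suc k)) 1#) ⟩
      - (y (suc k) * 1#)                 ≡⟨ cong -_ (*-identityʳ (y (suc k))) ⟩
      - y (suc k)                        ∎

  B-column-suc : ∀ {n} (x y : Vector R (suc n)) l → sum (λ j → y j * B-matrix x j (suc l)) ≡ y zero * x (suc l) + y (suc l)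
  B-column-suc x y l = cong (y zero * x (suc l) +_) (trans (sum-cong-≗ term) (sum-δʳ l (y ∘ suc)))
    where
    term : ∀ k → y (suc k) * (δ (suc k) (suc l) - δ zero (suc l)) ≡ y (suc k) * δ k l
    term k = cong (y (suc k) *_) (begin
      δ (suc k) (suc l) - δ zero (suc l) ≡⟨ cong₂ _-_ (δ-punchIn zero k l) (δ-off {i = zero} {suc l} (λ ())) ⟩
      δ k l - 0#                         ≡⟨ cong (δ k l +_) -0#≈0# ⟩
      δ k l + 0#                         ≡⟨ +-identityʳ (δ k l) ⟩
      δ k l                              ∎)

  fromℕ : ℕ → R
  fromℕ zero    = 0#
  fromℕ (suc n) = 1# + fromℕ n

  incidence : ∀ {n} → Subset n → Vector R n
  incidence B k with k ∈? B
  ... | yes _ = 1#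
  ... | no  _ = 0#

  incidence-∷ : ∀ {n} x (B : Subset n) k → incidence (x Vec.∷ B) (suc k) ≡ incidence B k
  incidence-∷ x B k with k ∈? B
  ... | yes _ = refl
  ... | no  _ = refl

  incidence-sum : ∀ {n} (B : Subset n) → sum (incidence B) ≡ fromℕ ∣ B ∣ₛ
  incidence-sum Vec.[]              = refl
  incidence-sum (inside Vec.∷ B)  = cong (1# +_) (trans (sum-cong-≗ (incidence-∷ inside B)) (incidence-sum B))
  incidence-sum (outside Vec.∷ B) = trans (+-identityˡ _) (trans (sum-cong-≗ (incidence-∷ outside B)) (incidence-sum B))

  bit : ℤ → R
  bit (ℤ.+ zero) = 0#
  bit _        = 1#

  incidence-bit : ∀ {n} (B : Subset n) k → incidence B k ≡ bit (incℤ B k)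
  incidence-bit B k with k ∈? B
  ... | yes _ = refl
  ... | no  _ = refl

  δ-bit : ∀ {n} (a k : Fin n) → δ a k ≡ bit (eℤ a k)
  δ-bit a k with a ≟ k
  ... | yes _ = refl
  ... | no  _ = refl

  bit-difference-R : ∀ {a b c d} → Bit a → Bit b → Bit c → Bit d → a ℤ.- b ≡ c ℤ.- d → bit a - bit b ≡ bit c - bit d
  bit-difference-R a b c d eq with bit-difference a b c d eq
  ... | inj₁ (refl , refl) = refl
  ... | inj₂ (refl , refl) = trans (-‿inverseʳ _) (sym (-‿inverseʳ _))

  edge-difference : ∀ {n} (X : Fin n → Subset n) {s t a b} → DiffIsEdge (matℤ X s) (matℤ X t) a b →
                    ∀ l → incidence (X s) l - incidence (X t) l ≡ δ a l - δ b l
  edge-difference X {s} {t} {a} {b} edge l = begin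
    incidence (X s) l - incidence (X t) l       ≡⟨ cong₂ _-_ (incidence-bit (X s) l) (incidence-bit (X t) l) ⟩
    bit (incℤ (X s) l) - bit (incℤ (X t) l)
      ≡⟨ bit-difference-R (incℤ-bit (X s) l) (incℤ-bit (X t) l) (eℤ-bit a l) (eℤ-bit b l) (edge l) ⟩
    bit (eℤ a l) - bit (eℤ b l)                 ≡⟨ sym (cong₂ _-_ (δ-bit a l) (δ-bit b l)) ⟩
    δ a l - δ b l                               ∎

  module WalkCertificates {n} (X : Fin n → Subset n) where

    M : Mat n n
    M s = incidence (X s)

    Balanced : Vector R n → Set
    Balanced ψ = ∀ s t → GEdge X s t → ψ s ≡ ψ t

    record Certificate (u v : Fin n) : Set where
      field
        w           : Vector R n
        combination : ∀ l → sum (λ s → w s * M s l) ≡ δ u l - δ v l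
        annihilates : ∀ ψ → Balanced ψ → sum (λ s → w s * ψ s) ≡ 0#
    open Certificate

    trivial : ∀ u → Certificate u u
    trivial u = record
      { w           = const 0#
      ; combination = λ l → trans (sum-zero (λ s → zeroˡ (M s l))) (sym (-‿inverseʳ (δ u l)))
      ; annihilates = λ ψ _ → sum-zero (λ s → zeroˡ (ψ s))
      }

    -- an edge {u, a} of g(X) comes from rows with e_{X_s} - e_{X_t} = e_u - e_a, which form an edge of G(X)
    edge : ∀ {u a} → gEdge X u a → Certificate u a
    edge {u} {a} (s , t , s-t) = record
      { w           = λ σ → δ s σ - δ t σ
      ; combination = λ l → trans (sum-δ-difference s t (λ σ → M σ l)) (edge-difference X s-t l)
      ; annihilates = λ ψ balanced → trans (sum-δ-difference s t ψ)
                                       (trans (cong (λ z → ψ s - z) (sym (balanced s t (u , a , s-t)))) (-‿inverseʳ (ψ s)))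
      }

    reverse : ∀ {u v} → Certificate u v → Certificate v u
    reverse {u} {v} c = record
      { w           = λ s → - w c s
      ; combination = λ l → trans (sum-neg-coefficients (w c) (λ s → M s l))
                                  (trans (cong -_ (combination c l)) (-‿flip (δ u l) (δ v l)))
      ; annihilates = λ ψ balanced → trans (sum-neg-coefficients (w c) ψ)
                                       (trans (cong -_ (annihilates c ψ balanced)) -0#≈0#)
      }

    concat : ∀ {u a v} → Certificate u a → Certificate a v → Certificate u v
    concat {u} {a} {v} c d = record
      { w           = λ s → w c s + w d s
      ; combination = λ l → trans (sum-+-coefficients (w c) (w d) (λ s → M s l))
                                  (trans (cong₂ _+_ (combination c l) (combination d l)) (telescope (δ u l) (δ a l) (δ v l)))
      ; annihilates = λ ψ balanced → trans (sum-+-coefficients (w c) (w d) ψ)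
                                       (trans (cong₂ _+_ (annihilates c ψ balanced) (annihilates d ψ balanced)) (+-identityˡ 0#))
      }

    walk : ∀ {u v} → Star (λ a b → gEdge X a b ⊎ gEdge X b a) u v → Certificate u v
    walk {u} ε                 = trivial u
    walk (inj₁ e ◅ rest) = concat (edge e) (walk rest)
    walk (inj₂ e ◅ rest) = concat (reverse (edge e)) (walk rest)

    outside-indicator : Subset n → Vector R n
    outside-indicator S σ with σ ∈? S
    ... | yes _ = 0#
    ... | no  _ = 1#

    outside-indicator-balanced : ∀ S → (∀ s t → GEdge X s t → s ∈ S → t ∈ S) → (∀ s t → GEdge X s t → t ∈ S → s ∈ S) →
                                 Balanced (outside-indicator S)
    outside-indicator-balanced S forward backward s t st with s ∈? S | t ∈? S
    ... | yes _  | yes _  = refl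
    ... | no  _  | no  _  = refl
    ... | yes s∈ | no t∉  = ⊥-elim (t∉ (forward s t st s∈))
    ... | no s∉  | yes t∈ = ⊥-elim (s∉ (backward s t st t∈))

  module IncidenceMatrix {m} (X : Fin (suc m) → Subset (suc m)) (r : ℕ) (rank : ∀ s → ∣ X s ∣ₛ ≡ r)
                         (g-connected : GraphConnected (gEdge X)) where
    open WalkCertificates X public

    n : ℕ
    n = suc m

    x : Vector R n
    x = M zero

    row-sum : ∀ s → sum (M s) ≡ fromℕ r
    row-sum s = trans (incidence-sum (X s)) (cong fromℕ (rank s))

    P : Mat n n
    P zero    = δ zero
    P (suc k) = Certificate.w (walk (g-connected (suc k) zero))

    P·M≋B : P · M ≋ B-matrix x
    P·M≋B zero    l = sum-δˡ zero (λ σ → M σ l)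
    P·M≋B (suc k) l = Certificate.combination (walk (g-connected (suc k) zero)) l

    Det-P*Det-M : Det n P * Det n M ≡ fromℕ r
    Det-P*Det-M = begin
      Det n P * Det n M      ≡⟨ sym (Det-· n P M) ⟩
      Det n (P · M)          ≡⟨ Det-cong n P·M≋B ⟩
      Det n (B-matrix x)     ≡⟨ Det-B-matrix m x ⟩
      sum x                  ≡⟨ row-sum zero ⟩
      fromℕ r                ∎

    -- Q: the coordinates of the rows of X with respect to the rows of B, so that X = Q · B.
    Q : Mat n n
    Q s = 1# ∷ (λ k → M s (suc k) - x (suc k))

    Q·B≋M : Q · B-matrix x ≋ M
    Q·B≋M s zero    = begin
      (Q · B-matrix x) s zero                          ≡⟨ B-column-zero x (Q s) ⟩
      1# * x zero - sum (λ k → M s (suc k) - x (suc k)) ≡⟨ cong₂ _-_ (*-identityˡ (x zero)) (sum-sub (M s ∘ suc) (x ∘ suc)) ⟩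
      x zero - (Σ-Mₛ - Σ-x)                            ≡⟨ cong (x zero +_) (-‿flip Σ-Mₛ Σ-x) ⟩
      x zero + (Σ-x - Σ-Mₛ)                            ≡⟨ sym (+-assoc (x zero) Σ-x (- Σ-Mₛ)) ⟩
      sum x - Σ-Mₛ                                     ≡⟨ cong (_- Σ-Mₛ) (trans (row-sum zero) (sym (row-sum s))) ⟩
      (M s zero + Σ-Mₛ) - Σ-Mₛ                         ≡⟨ +-assoc (M s zero) Σ-Mₛ (- Σ-Mₛ) ⟩
      M s zero + (Σ-Mₛ - Σ-Mₛ)
        ≡⟨ trans (cong (M s zero +_) (-‿inverseʳ Σ-Mₛ)) (+-identityʳ (M s zero)) ⟩
      M s zero                                         ∎
      where
      Σ-Mₛ Σ-x : R
      Σ-Mₛ = sum (M s ∘ suc)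
      Σ-x  = sum (x ∘ suc)
    Q·B≋M s (suc l) = trans (B-column-suc x (Q s) l)
                            (trans (cong (_+ Q s (suc l)) (*-identityˡ (x (suc l)))) (x+[y-x]≡y (x (suc l)) (M s (suc l))))

    Det-M≡Det-Q*r : Det n M ≡ Det n Q * fromℕ r
    Det-M≡Det-Q*r = begin
      Det n M                       ≡⟨ sym (Det-cong n Q·B≋M) ⟩
      Det n (Q · B-matrix x)        ≡⟨ Det-· n Q (B-matrix x) ⟩
      Det n Q * Det n (B-matrix x)  ≡⟨ cong (Det n Q *_) (trans (Det-B-matrix m x) (row-sum zero)) ⟩
      Det n Q * fromℕ r             ∎

    -- If a set S containing row 0 is closed under the edges of G(X) but misses b,
    -- the indicator of its complement lies in the kernel of P, so P is singular.
    Det-P-vanishes : ∀ S → zero ∈ S →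
                     (∀ s t → GEdge X s t → s ∈ S → t ∈ S) → (∀ s t → GEdge X s t → t ∈ S → s ∈ S) →
                     ∀ b → b ∉ S → Det n P ≡ 0#
    Det-P-vanishes S 0∈S forward backward b b∉S = Det-kernel n P ψ b ψ-b P·ψ≡0
      where
      ψ : Vector R n
      ψ = outside-indicator S
      ψ-b : ψ b ≡ 1#
      ψ-b with b ∈? S
      ... | yes b∈S = ⊥-elim (b∉S b∈S)
      ... | no  _   = refl
      ψ-0 : ψ zero ≡ 0#
      ψ-0 with zero ∈? S
      ... | yes _   = refl
      ... | no  0∉S = ⊥-elim (0∉S 0∈S)
      P·ψ≡0 : ∀ i → sum (λ l → P i l * ψ l) ≡ 0#
      P·ψ≡0 zero    = trans (sum-δˡ zero ψ) ψ-0
      P·ψ≡0 (suc k) = Certificate.annihilates (walk (g-connected (suc k) zero)) ψ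
                                              (outside-indicator-balanced S forward backward)

module Reachability {N : ℕ} (E : Fin N → Fin N → Set) (E? : ∀ a b → Dec (E a b)) (o : Fin N) where

  record ReachableSet : Set where
    field
      S       : Subset N
      source  : o ∈ S
      reached : ∀ v → v ∈ S → Star E o v
      closed  : ∀ v w → v ∈ S → E v w → w ∈ S

  -- add an outgoing neighbour while one exists; the set strictly grows, so this terminates
  grow : ∀ S → Acc _⊃_ S → o ∈ S → (∀ v → v ∈ S → Star E o v) → ReachableSet
  grow S (acc smaller) o∈S reached
    with any? (λ v → any? (λ w → ((v ∈? S) ×-dec (¬? (w ∈? S))) ×-dec E? v w))
  ... | yes (v , w , (v∈S , w∉S) , vw) =
    grow (S ∪ ⁅ w ⁆) (smaller (p⊆p∪q ⁅ w ⁆ , w , x∈p∪q⁺ (inj₂ (x∈⁅x⁆ w)) , w∉S)) (p⊆p∪q ⁅ w ⁆ o∈S) reached′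
    where
    reached′ : ∀ u → u ∈ S ∪ ⁅ w ⁆ → Star E o u
    reached′ u u∈ with x∈p∪q⁻ S ⁅ w ⁆ u∈
    ... | inj₁ u∈S = reached u u∈S
    ... | inj₂ u∈w rewrite x∈⁅y⁆⇒x≡y w u∈w = reached v v∈S ◅◅ (vw ◅ ε)
  ... | no no-exit = record { S = S ; source = o∈S ; reached = reached ; closed = closed }
    where
    closed : ∀ v w → v ∈ S → E v w → w ∈ S
    closed v w v∈S vw with w ∈? S
    ... | yes w∈S = w∈S
    ... | no  w∉S = ⊥-elim (no-exit (v , w , (v∈S , w∉S) , vw))

  reachable-set : ReachableSet
  reachable-set = grow ⁅ o ⁆ (⊃-wellFounded _) (x∈⁅x⁆ o) (λ v v∈ → subst (Star E o) (sym (x∈⁅y⁆⇒x≡y o v∈)) ε)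

module ℤ-algebra = LinearAlgebra ℤP.+-*-isCommutativeRing
module ℚ-algebra = LinearAlgebra ℚP.+-*-isCommutativeRing

sumℤ≡sum : ∀ n f → sumℤ n f ≡ ℤ-algebra.sum f
sumℤ≡sum zero    f = refl
sumℤ≡sum (suc n) f = cong (λ z → f zero ℤ.+ z) (sumℤ≡sum n (f ∘ suc))

sumℚ≡sum : ∀ n f → sumℚ n f ≡ ℚ-algebra.sum f
sumℚ≡sum zero    f = refl
sumℚ≡sum (suc n) f = cong (λ z → f zero ℚ.+ z) (sumℚ≡sum n (f ∘ suc))

sgn≡sign : ∀ k → sgn k ≡ ℤ-algebra.sign k
sgn≡sign zero    = refl
sgn≡sign (suc k) = cong ℤ.-_ (sgn≡sign k)

det≡Det : ∀ n A → det n A ≡ ℤ-algebra.Det n A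
det≡Det zero    A = refl
det≡Det (suc n) A = trans (sumℤ≡sum (suc n) (λ j → sgn (toℕ j) ℤ.* (A zero j ℤ.* det n (ℤ-algebra.minor A j))))
  (ℤ-algebra.sum-cong-≗ (λ j → cong₂ (λ s d → s ℤ.* (A zero j ℤ.* d)) (sgn≡sign (toℕ j)) (det≡Det n (ℤ-algebra.minor A j))))

matℤ≡incidence : ∀ {n} (X : Fin n → Subset n) i k → matℤ X i k ≡ ℤ-algebra.incidence (X i) k
matℤ≡incidence X i k with k ∈? X i
... | yes _ = refl
... | no  _ = refl

matℚ≡incidence : ∀ {n} (X : Fin n → Subset n) i k → matℚ X i k ≡ ℚ-algebra.incidence (X i) k
matℚ≡incidence X i k with k ∈? X i
... | yes _ = refl
... | no  _ = refl

fromℕ-ℤ : ∀ r → ℤ-algebra.fromℕ r ≡ ℤ.+ r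
fromℕ-ℤ zero    = refl
fromℕ-ℤ (suc r) = cong (λ z → ℤ.+ 1 ℤ.+ z) (fromℕ-ℤ r)

fromℕ-ℚ-positive : ∀ r → ℚ.Positive (ℚ-algebra.fromℕ (suc r))
fromℕ-ℚ-nonNegative : ∀ r → ℚ.NonNegative (ℚ-algebra.fromℕ r)
fromℕ-ℚ-positive r = ℚP.pos+nonNeg⇒pos 1ℚ (ℚ-algebra.fromℕ r) {{fromℕ-ℚ-nonNegative r}}
fromℕ-ℚ-nonNegative zero    = _
fromℕ-ℚ-nonNegative (suc r) = ℚP.pos⇒nonNeg (ℚ-algebra.fromℕ (suc r)) {{fromℕ-ℚ-positive r}}

fromℕ-ℚ-nonzero : ∀ r → ℚ-algebra.fromℕ (suc r) ≢ 0ℚ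
fromℕ-ℚ-nonzero r eq = ℚP.<-irrefl (sym eq) (ℚP.positive⁻¹ _ {{fromℕ-ℚ-positive r}})

ℚ-cancel : ∀ x y → x ℚ.* y ≡ 0ℚ → y ≢ 0ℚ → x ≡ 0ℚ
ℚ-cancel x y xy≡0 y≢0 = begin
  x                        ≡⟨ sym (ℚP.*-identityʳ x) ⟩
  x ℚ.* 1ℚ                 ≡⟨ cong (x ℚ.*_) (sym (ℚP.*-inverseʳ y)) ⟩
  x ℚ.* (y ℚ.* ℚ.1/ y)     ≡⟨ sym (ℚP.*-assoc x y _) ⟩
  (x ℚ.* y) ℚ.* ℚ.1/ y     ≡⟨ cong (ℚ._* _) xy≡0 ⟩
  0ℚ ℚ.* ℚ.1/ y            ≡⟨ ℚP.*-zeroˡ (ℚ.1/ y) ⟩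
  0ℚ                       ∎
  where
  open ≡-Reasoning
  instance
    y-nonZero : ℚ.NonZero y
    y-nonZero = ℚ.≢-nonZero y≢0

GEdge? : ∀ {n} (X : Fin n → Subset n) a b → Dec (GEdge X a b)
GEdge? X a b = any? λ s → any? λ t → all? λ k → (matℤ X a k ℤ.- matℤ X b k) ℤ.≟ (eℤ s k ℤ.- eℤ t k)

module _ {m : ℕ} (X : Fin (suc m) → Subset (suc m)) (r : ℕ) (rank : ∀ s → ∣ X s ∣ₛ ≡ suc r)
         (g-connected : GraphConnected (gEdge X)) where
  private
    module Xℤ = ℤ-algebra.IncidenceMatrix X (suc r) rank g-connected
    module Xℚ = ℚ-algebra.IncidenceMatrix X (suc r) rank g-connected
    open ≡-Reasoning

    det-P det-Q det-M : ℤ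
    det-P = ℤ-algebra.Det (suc m) Xℤ.P
    det-Q = ℤ-algebra.Det (suc m) Xℤ.Q
    det-M = ℤ-algebra.Det (suc m) Xℤ.M

    -- P X = B and X = Q B with det B = r give det P · det Q = 1 over ℤ
    det-P*det-Q≡1 : det-P ℤ.* det-Q ≡ ℤ.+ 1
    det-P*det-Q≡1 = ℤP.*-cancelʳ-≡ _ _ (ℤ.+ suc r) (begin
      (det-P ℤ.* det-Q) ℤ.* ℤ.+ suc r  ≡⟨ ℤP.*-assoc det-P det-Q _ ⟩
      det-P ℤ.* (det-Q ℤ.* ℤ.+ suc r)  ≡⟨ cong (λ z → det-P ℤ.* (det-Q ℤ.* z)) (sym (fromℕ-ℤ (suc r))) ⟩
      det-P ℤ.* (det-Q ℤ.* ℤ-algebra.fromℕ (suc r)) ≡⟨ cong (det-P ℤ.*_) (sym Xℤ.Det-M≡Det-Q*r) ⟩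
      det-P ℤ.* det-M                  ≡⟨ Xℤ.Det-P*Det-M ⟩
      ℤ-algebra.fromℕ (suc r)          ≡⟨ fromℕ-ℤ (suc r) ⟩
      ℤ.+ suc r                        ≡⟨ sym (ℤP.*-identityˡ _) ⟩
      ℤ.+ 1 ℤ.* ℤ.+ suc r              ∎)

  -- det X = det Q · r with det Q = ±1
  |det-X|≡r : ∣ det (suc m) (matℤ X) ∣ ≡ suc r
  |det-X|≡r = begin
    ∣ det (suc m) (matℤ X) ∣
      ≡⟨ cong ∣_∣ (trans (det≡Det (suc m) (matℤ X)) (ℤ-algebra.Det-cong (suc m) (matℤ≡incidence X))) ⟩
    ∣ det-M ∣                                    ≡⟨ cong ∣_∣ Xℤ.Det-M≡Det-Q*r ⟩
    ∣ det-Q ℤ.* ℤ-algebra.fromℕ (suc r) ∣         ≡⟨ ℤP.abs-* det-Q _ ⟩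
    ∣ det-Q ∣ ℕ.* ∣ ℤ-algebra.fromℕ (suc r) ∣     ≡⟨ cong₂ ℕ._*_ |det-Q|≡1 (cong ∣_∣ (fromℕ-ℤ (suc r))) ⟩
    1 ℕ.* suc r                                  ≡⟨ ℕP.*-identityˡ (suc r) ⟩
    suc r                                        ∎
    where
    |det-Q|≡1 : ∣ det-Q ∣ ≡ 1
    |det-Q|≡1 = ℕP.m*n≡1⇒n≡1 ∣ det-P ∣ ∣ det-Q ∣ (trans (sym (ℤP.abs-* det-P det-Q)) (cong ∣_∣ det-P*det-Q≡1))

  -- the component of row 0 in G(X) is everything, as otherwise det P = 0
  G-connected : GraphConnected (GEdge X)
  G-connected u v = Star-reverse symmetric (reached u (everything u)) ◅◅ reached v (everything v)
    where
    E : Fin (suc m) → Fin (suc m) → Set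
    E a b = GEdge X a b ⊎ GEdge X b a
    symmetric : ∀ {a b} → E a b → E b a
    symmetric (inj₁ ab) = inj₂ ab
    symmetric (inj₂ ba) = inj₁ ba
    open Reachability.ReachableSet (Reachability.reachable-set E (λ a b → GEdge? X a b ⊎-dec GEdge? X b a) zero)
    everything : ∀ b → b ∈ S
    everything b with b ∈? S
    ... | yes b∈S = b∈S
    ... | no  b∉S = ⊥-elim (0≢1 (begin
      ℤ.+ 0                ≡⟨ sym (ℤP.*-zeroˡ det-Q) ⟩
      ℤ.+ 0 ℤ.* det-Q      ≡⟨ cong (ℤ._* det-Q) (sym det-P≡0) ⟩
      det-P ℤ.* det-Q      ≡⟨ det-P*det-Q≡1 ⟩
      ℤ.+ 1                ∎))
      where
      det-P≡0 : det-P ≡ ℤ.+ 0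
      det-P≡0 = Xℤ.Det-P-vanishes S source (λ s t st s∈ → closed s t s∈ (inj₁ st))
                                           (λ s t st t∈ → closed t s t∈ (inj₂ st)) b b∉S
      0≢1 : ℤ.+ 0 ≢ ℤ.+ 1
      0≢1 ()

  -- over ℚ, det X ≠ 0, so a vanishing combination of the rows is trivial
  rank-full : RankFull (suc m) (matℚ X)
  rank-full c relation i = ℚ-cancel (c i) _ (ℚ-algebra.Det-annihilates-relations (suc m) Xℚ.M c relation′ i) Det-M≢0
    where
    relation′ : ∀ k → ℚ-algebra.sum (λ j → c j ℚ.* Xℚ.M j k) ≡ 0ℚ
    relation′ k = begin
      ℚ-algebra.sum (λ j → c j ℚ.* Xℚ.M j k)  ≡⟨ ℚ-algebra.sum-cong-≗ (λ j → cong (c j ℚ.*_) (sym (matℚ≡incidence X j k))) ⟩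
      ℚ-algebra.sum (λ j → c j ℚ.* matℚ X j k) ≡⟨ sym (sumℚ≡sum (suc m) (λ j → c j ℚ.* matℚ X j k)) ⟩
      sumℚ (suc m) (λ j → c j ℚ.* matℚ X j k)  ≡⟨ relation k ⟩
      0ℚ                                        ∎
    Det-M≢0 : ℚ-algebra.Det (suc m) Xℚ.M ≢ 0ℚ
    Det-M≢0 Det-M≡0 = fromℕ-ℚ-nonzero r (begin
      ℚ-algebra.fromℕ (suc r)                                      ≡⟨ sym Xℚ.Det-P*Det-M ⟩
      ℚ-algebra.Det (suc m) Xℚ.P ℚ.* ℚ-algebra.Det (suc m) Xℚ.M    ≡⟨ cong (ℚ-algebra.Det (suc m) Xℚ.P ℚ.*_) Det-M≡0 ⟩
      ℚ-algebra.Det (suc m) Xℚ.P ℚ.* 0ℚ                           ≡⟨ ℚP.*-zeroʳ (ℚ-algebra.Det (suc m) Xℚ.P) ⟩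
      0ℚ                                                          ∎)

rank-of-empty : ∀ {r} (M : Matroid 0) → HasRank M r → r ≡ 0
rank-of-empty M hasRank with Matroid.nonempty M
... | Vec.[] , isBasis = sym (hasRank Vec.[] isBasis)

-- Theorem 14. For n = 0 the hypotheses are contradictory, since then r = 0.
mainTheorem14 : ∀ (n r : ℕ) (M : Matroid n) → Connected M → HasRank M r → 1 ≤ r →
    (X : Fin n → Subset n) → Injective _≡_ _≡_ X → (∀ i → Matroid.IsBasis M (X i)) →
    GraphConnected (gEdge X) →
    RankFull n (matℚ X) × GraphConnected (GEdge X) × ∣ det n (matℤ X) ∣ ≡ r
mainTheorem14 zero    r       M _ hasRank 1≤r X _ _ _ with rank-of-empty M hasRank
mainTheorem14 zero    .zero   M _ hasRank () X _ _ _ | refl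
mainTheorem14 (suc m) zero    M _ hasRank () X _ _ _
mainTheorem14 (suc m) (suc r) M _ hasRank _ X _ bases g-connected =
  rank-full X r rank g-connected , G-connected X r rank g-connected , |det-X|≡r X r rank g-connected
  where
  rank : ∀ s → ∣ X s ∣ₛ ≡ suc r
  rank s = hasRank (X s) (bases s)
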